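{- Let $\dot G$ be a signed graph on $n$ vertices with $\det(xI-A_{\dot G})=x^{m_0}\prod_{i=1}^{l}(x^2-\lambda_i)^{m_i}$. Then $\det\big(xI-A_{\dot G\ltimes K_2}\big)=(x^2-1)^{m_0}\prod_{i=1}^{l}(x^2-\lambda_i-1)^{2m_i}$.
   Context: A signed graph $\dot G=(G,\sigma)$ consists of a simple graph $G$ and $\sigma:E(G)\to\{1,-1\}$; its adjacency matrix $A_{\dot G}$ is that of $G$ with entries of negative edges replaced by $-1$. The signed graph $\dot G\ltimes K_2$ is obtained from two copies of $\dot G$ by joining each vertex to its copy by a positive edge and reversing the sign of every edge in exactly one of the two copies; equivalently its adjacency matrix is $\begin{bmatrix} A_{\dot G} & I_n\\ I_n & -A_{\dot G}\end{bmatrix}$. -}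

module Defs where

open import Level using (Level)
open import Data.Nat using (ℕ; zero; suc)
import Data.Nat as N
open import Data.Fin using (Fin; zero; suc; punchIn; splitAt; _≟_)
open import Data.Sum using (_⊎_; inj₁; inj₂)
open import Data.Maybe using (Maybe; just; nothing)
import Data.Maybe as Maybe
open import Data.Sign as S using (Sign)
open import Data.Bool using (Bool; true; false; if_then_else_)
open import Data.List using (List; []; _∷_)
import Data.List as List
open import Relation.Nullary using (yes; no; does)
open import Relation.Binary.PropositionalEquality using (_≡_; refl; sym; cong)
open import Algebra.Bundles using (CommutativeRing)
open import Function using (_∘_)

-- Signed graphs (simple underlying graph: symmetric, loopless).
-- edge i j = nothing : no edge;  just S.+ : positive edge;  just S.- : negative edge.

record SignedGraph (n : ℕ) : Set where
  field
    edge     : Fin n → Fin n → Maybe Sign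
    edgeSym  : ∀ i j → edge i j ≡ edge j i
    loopless : ∀ i → edge i i ≡ nothing
open SignedGraph public

-- Vertex set of G ⋉ K₂ is Fin (n + n) = first copy ⊎ second copy (via splitAt).
private
  ⋉edge : ∀ {n} → SignedGraph n → Fin n ⊎ Fin n → Fin n ⊎ Fin n → Maybe Sign
  ⋉edge G (inj₁ i) (inj₁ j) = edge G i j
  ⋉edge G (inj₂ i) (inj₂ j) = Maybe.map S.opposite (edge G i j)
  ⋉edge G (inj₁ i) (inj₂ j) = if does (i ≟ j) then just S.+ else nothing
  ⋉edge G (inj₂ i) (inj₁ j) = if does (i ≟ j) then just S.+ else nothing

  ifSym : ∀ {n} (i j : Fin n) →
          (if does (i ≟ j) then just S.+ else nothing) ≡ (if does (j ≟ i) then just S.+ else nothing)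
  ifSym i j with i ≟ j | j ≟ i
  ... | yes _ | yes _ = refl
  ... | no _ | no _ = refl
  ... | yes p | no q with q (sym p)
  ... | ()
  ifSym i j | no p | yes q with p (sym q)
  ... | ()

  ⋉sym : ∀ {n} (G : SignedGraph n) u v → ⋉edge G u v ≡ ⋉edge G v u
  ⋉sym G (inj₁ i) (inj₁ j) = edgeSym G i j
  ⋉sym G (inj₂ i) (inj₂ j) = cong (Maybe.map S.opposite) (edgeSym G i j)
  ⋉sym G (inj₁ i) (inj₂ j) = ifSym i j
  ⋉sym G (inj₂ i) (inj₁ j) = ifSym i j

  ⋉loop : ∀ {n} (G : SignedGraph n) u → ⋉edge G u u ≡ nothing
  ⋉loop G (inj₁ i) = loopless G i
  ⋉loop G (inj₂ i) = cong (Maybe.map S.opposite) (loopless G i)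

_⋉K₂ : ∀ {n} → SignedGraph n → SignedGraph (n N.+ n)
_⋉K₂ {n} G = record
  { edge     = λ u v → ⋉edge G (splitAt n u) (splitAt n v)
  ; edgeSym  = λ u v → ⋉sym G (splitAt n u) (splitAt n v)
  ; loopless = λ u → ⋉loop G (splitAt n u)
  }

module Det {a} {A : Set a} (_+'_ _*'_ : A → A → A) (neg : A → A) (0' 1' : A) where
  altSum : ∀ {m} → (Fin m → A) → A
  altSum {zero}  f = 0'
  altSum {suc m} f = f zero +' neg (altSum (f ∘ suc))

  det : ∀ n → (Fin n → Fin n → A) → A
  det zero    M = 1'
  det (suc n) M = altSum (λ j → M zero j *' det n (λ i k → M (suc i) (punchIn j k)))

-- Polynomials over a commutative ring R, as coefficient lists (constant
-- term first), with equality = equality of all coefficients.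

module Poly {c ℓ} (R : CommutativeRing c ℓ) where
  open CommutativeRing R using (Carrier; _≈_; _+_; _*_; -_; 0#; 1#)

  Pol : Set c
  Pol = List Carrier

  coeff : Pol → ℕ → Carrier
  coeff []       k       = 0#
  coeff (a ∷ p)  zero    = a
  coeff (a ∷ p)  (suc k) = coeff p k

  infix 4 _≈ₚ_
  _≈ₚ_ : Pol → Pol → Set ℓ
  p ≈ₚ q = ∀ k → coeff p k ≈ coeff q k

  infixl 6 _+ₚ_ _-ₚ_
  infixl 7 _*ₚ_
  infixr 8 _^ₚ_

  _+ₚ_ : Pol → Pol → Pol
  []      +ₚ q       = q
  (a ∷ p) +ₚ []      = a ∷ p
  (a ∷ p) +ₚ (b ∷ q) = (a + b) ∷ (p +ₚ q)

  -ₚ_ : Pol → Pol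
  -ₚ p = List.map -_ p

  _-ₚ_ : Pol → Pol → Pol
  p -ₚ q = p +ₚ (-ₚ q)

  _*ₚ_ : Pol → Pol → Pol
  []      *ₚ q = []
  (a ∷ p) *ₚ q = List.map (a *_) q +ₚ (0# ∷ (p *ₚ q))

  const : Carrier → Pol
  const a = a ∷ []

  0ₚ 1ₚ X : Pol
  0ₚ = []
  1ₚ = const 1#
  X  = 0# ∷ 1# ∷ []

  _^ₚ_ : Pol → ℕ → Pol
  p ^ₚ zero  = 1ₚ
  p ^ₚ suc k = p *ₚ (p ^ₚ k)

  ∏ₚ : ∀ {l} → (Fin l → Pol) → Pol
  ∏ₚ {zero}  f = 1ₚ
  ∏ₚ {suc l} f = f zero *ₚ ∏ₚ (f ∘ suc)

  detₚ : ∀ n → (Fin n → Fin n → Pol) → Pol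
  detₚ = Det.det _+ₚ_ _*ₚ_ -ₚ_ 0ₚ 1ₚ

  signEntry : Maybe Sign → Carrier
  signEntry nothing       = 0#
  signEntry (just S.+)    = 1#
  signEntry (just S.-)    = - 1#

  adjacency : ∀ {n} → SignedGraph n → Fin n → Fin n → Carrier
  adjacency G i j = signEntry (edge G i j)

  charPoly : ∀ {n} → (Fin n → Fin n → Carrier) → Pol
  charPoly {n} A = detₚ n (λ i j → (if does (i ≟ j) then X else 0ₚ) -ₚ const (A i j))

module Submission where

-- The adjacency matrix of Ġ ⋉ K₂ is [[A, I], [I, -A]].  Adding P = xI - A times the lower
-- rows of [[xI - A, -I], [-I, xI + A]] to the upper ones (a Schur complement) shows that
-- its characteristic polynomial is det((x² - 1) I - A²) = q(x² - 1), where q is the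
-- characteristic polynomial of A².  From (xI - A)(xI + A) = x² I - A² we get
-- q(x²) = χ(x) · (-1)ⁿ χ(-x), and the assumed factorisation gives χ(-x) = (-1)^m₀ χ(x);
-- comparing the coefficients of xⁿ (χ is monic of degree n) forces (-1)^m₀ = (-1)ⁿ, so
-- q(x²) = χ(x)² = r(x²) with r = x^m₀ ∏ (x - λᵢ)^(2 mᵢ).  As p ↦ p(x²) is injective,
-- q = r, and the characteristic polynomial of Ġ ⋉ K₂ is r(x² - 1).

open import Algebra.Bundles using (CommutativeRing; Semiring)
open import Algebra.Morphism.Structures using (IsRingHomomorphism)
open import Data.Fin using (Fin)
open import Data.Nat using (ℕ)
open import Defs

module Determinant {c ℓ} (R : CommutativeRing c ℓ) where

  open import Data.Bool.Base using (true; false; if_then_else_)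
  open import Data.Empty using (⊥-elim)
  open import Data.Fin.Base using (Fin; zero; suc; punchIn; toℕ; fromℕ; inject₁; splitAt; join; _↑ˡ_; _↑ʳ_)
  open import Data.Fin.Properties
    using ( _≟_; suc-injective; toℕ-injective; toℕ-inject₁; toℕ-fromℕ; toℕ<n; toℕ-↑ˡ; toℕ-↑ʳ
          ; splitAt-↑ˡ; splitAt-↑ʳ; join-splitAt; ↑ˡ-injective; ↑ʳ-injective)
  open import Data.Nat.Base as ℕ using (ℕ; zero; suc; _≤_; _∸_)
  import Data.Nat.Properties as ℕ
  open import Data.Sum.Base using (_⊎_; inj₁; inj₂; [_,_]′; map₁; swap)
  open import Function.Base using (_∘_)
  open import Relation.Binary.PropositionalEquality as ≡ using (_≡_; _≢_)
  open import Relation.Nullary.Decidable using (yes; no; does; dec-true; dec-false; does-⇔)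
  open import Function.Bundles using (mk⇔)

  open CommutativeRing R hiding (zero)
  open import Algebra.Properties.Ring ring using (-‿+-comm; -‿involutive; -0#≈0#; -‿distribˡ-*; -‿distribʳ-*; -1*x≈-x)
  open import Algebra.Properties.Semiring.Sum semiring public using (sum; sum-syntax)
  open import Algebra.Properties.Semiring.Sum semiring
    using (∑-distrib-+; *-distribʳ-sum; sum-cong-≋; sum-replicate-zero)
  open import Algebra.Properties.Semiring.Exp semiring public using (_^_)
  open import Algebra.Definitions.RawSemiring (Semiring.rawSemiring semiring) public using (product)
  open import Algebra.Properties.Semiring.Exp semiring using (^-homo-*)
  open import Algebra.Properties.CommutativeSemigroup *-commutativeSemigroup using (x∙yz≈y∙xz)
  open import Relation.Binary.Reasoning.Setoid setoid

  Matrix : ℕ → ℕ → Set c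
  Matrix m n = Fin m → Fin n → Carrier

  altSum : ∀ {m} → (Fin m → Carrier) → Carrier
  altSum = Det.altSum _+_ _*_ -_ 0# 1#

  det : ∀ {n} → Matrix n n → Carrier
  det = Det.det _+_ _*_ -_ 0# 1# _

  minor : ∀ {n} → Matrix (suc n) (suc n) → Fin (suc n) → Matrix n n
  minor M j i k = M (suc i) (punchIn j k)

  diagonal : ∀ {n} → Carrier → Matrix n n
  diagonal x i j = if does (i ≟ j) then x else 0#

  altSum-cong : ∀ {m} {f g : Fin m → Carrier} → (∀ j → f j ≈ g j) → altSum f ≈ altSum g
  altSum-cong {zero}  f≈g = refl
  altSum-cong {suc m} f≈g = +-cong (f≈g zero) (-‿cong (altSum-cong (f≈g ∘ suc)))

  altSum-+ : ∀ {m} (f g : Fin m → Carrier) → altSum (λ j → f j + g j) ≈ altSum f + altSum g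
  altSum-+ {zero}  f g = sym (+-identityˡ 0#)
  altSum-+ {suc m} f g = begin
    (f zero + g zero) + - altSum (λ j → f (suc j) + g (suc j))
      ≈⟨ +-congˡ (-‿cong (altSum-+ (f ∘ suc) (g ∘ suc))) ⟩
    (f zero + g zero) + - (altSum (f ∘ suc) + altSum (g ∘ suc))
      ≈⟨ +-congˡ (sym (-‿+-comm _ _)) ⟩
    (f zero + g zero) + (- altSum (f ∘ suc) + - altSum (g ∘ suc))
      ≈⟨ interchange _ _ _ _ ⟩
    (f zero + - altSum (f ∘ suc)) + (g zero + - altSum (g ∘ suc)) ∎
    where open import Algebra.Properties.CommutativeSemigroup +-commutativeSemigroup using (interchange)

  *-distribˡ-altSum : ∀ {m} x (f : Fin m → Carrier) → x * altSum f ≈ altSum (λ j → x * f j)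
  *-distribˡ-altSum {zero}  x f = zeroʳ x
  *-distribˡ-altSum {suc m} x f = begin
    x * (f zero + - altSum (f ∘ suc))         ≈⟨ distribˡ x _ _ ⟩
    x * f zero + x * - altSum (f ∘ suc)       ≈⟨ +-congˡ (sym (-‿distribʳ-* x _)) ⟩
    x * f zero + - (x * altSum (f ∘ suc))     ≈⟨ +-congˡ (-‿cong (*-distribˡ-altSum x (f ∘ suc))) ⟩
    x * f zero + - altSum (λ j → x * f (suc j)) ∎

  altSum-neg : ∀ {m} (f : Fin m → Carrier) → altSum (λ j → - f j) ≈ - altSum f
  altSum-neg {zero}  f = sym -0#≈0#
  altSum-neg {suc m} f = begin
    - f zero + - altSum (λ j → - f (suc j)) ≈⟨ +-congˡ (-‿cong (altSum-neg (f ∘ suc))) ⟩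
    - f zero + - - altSum (f ∘ suc)         ≈⟨ -‿+-comm _ _ ⟩
    - (f zero + - altSum (f ∘ suc))         ∎

  altSum-zero : ∀ {m} (f : Fin m → Carrier) → (∀ j → f j ≈ 0#) → altSum f ≈ 0#
  altSum-zero {zero}  f f≈0 = refl
  altSum-zero {suc m} f f≈0 = begin
    f zero + - altSum (f ∘ suc) ≈⟨ +-cong (f≈0 zero) (-‿cong (altSum-zero (f ∘ suc) (f≈0 ∘ suc))) ⟩
    0# + - 0#                   ≈⟨ -‿inverseʳ 0# ⟩
    0#                          ∎

  sum-zero : ∀ {m} (f : Fin m → Carrier) → (∀ j → f j ≈ 0#) → sum f ≈ 0#
  sum-zero {m} f f≈0 = trans (sum-cong-≋ f≈0) (sum-replicate-zero m)

  -1^-square : ∀ n → (- 1#) ^ n * (- 1#) ^ n ≈ 1#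
  -1^-square zero    = *-identityˡ 1#
  -1^-square (suc n) = begin
    (- 1# * (- 1#) ^ n) * (- 1# * (- 1#) ^ n) ≈⟨ *-cong (-1*x≈-x _) (-1*x≈-x _) ⟩
    - ((- 1#) ^ n) * - ((- 1#) ^ n)           ≈⟨ -‿distribˡ-* _ _ ⟨
    - ((- 1#) ^ n * - ((- 1#) ^ n))           ≈⟨ -‿cong (-‿distribʳ-* _ _) ⟨
    - - ((- 1#) ^ n * (- 1#) ^ n)             ≈⟨ -‿involutive _ ⟩
    (- 1#) ^ n * (- 1#) ^ n                   ≈⟨ -1^-square n ⟩
    1#                                        ∎

  -1^-parity : ∀ {a b c} → a ℕ.+ b ≡ c ℕ.+ c → (- 1#) ^ a ≈ (- 1#) ^ b
  -1^-parity {a} {b} {c} a+b≡c+c = begin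
    (- 1#) ^ a                                ≈⟨ *-identityʳ _ ⟨
    (- 1#) ^ a * 1#                           ≈⟨ *-congˡ (-1^-square b) ⟨
    (- 1#) ^ a * ((- 1#) ^ b * (- 1#) ^ b)    ≈⟨ *-assoc _ _ _ ⟨
    (- 1#) ^ a * (- 1#) ^ b * (- 1#) ^ b      ≈⟨ *-congʳ (^-homo-* (- 1#) a b) ⟨
    (- 1#) ^ (a ℕ.+ b) * (- 1#) ^ b           ≈⟨ *-congʳ (reflexive (≡.cong ((- 1#) ^_) a+b≡c+c)) ⟩
    (- 1#) ^ (c ℕ.+ c) * (- 1#) ^ b           ≈⟨ *-congʳ (trans (^-homo-* (- 1#) c c) (-1^-square c)) ⟩
    1# * (- 1#) ^ b                           ≈⟨ *-identityˡ _ ⟩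
    (- 1#) ^ b                                ∎

  -- Multilinearity in the rows

  det-cong : ∀ {n} {M N : Matrix n n} → (∀ i j → M i j ≈ N i j) → det M ≈ det N
  det-cong {zero}  M≈N = refl
  det-cong {suc n} M≈N = altSum-cong λ j → *-cong (M≈N zero j) (det-cong λ i k → M≈N (suc i) (punchIn j k))

  SameOffRow : ∀ {n} → Fin n → Matrix n n → Matrix n n → Set ℓ
  SameOffRow i M N = ∀ a → a ≢ i → ∀ b → M a b ≈ N a b

  minor-sameOffRow : ∀ {n} {i : Fin n} {M N : Matrix (suc n) (suc n)} →
                     SameOffRow (suc i) M N → ∀ j → SameOffRow i (minor M j) (minor N j)
  minor-sameOffRow M≈N j a a≢i b = M≈N (suc a) (a≢i ∘ suc-injective) (punchIn j b)

  det-additiveInRow : ∀ {n} (i : Fin n) {M N K : Matrix n n} → SameOffRow i M K → SameOffRow i N K →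
                      (∀ b → K i b ≈ M i b + N i b) → det K ≈ det M + det N
  det-additiveInRow {suc n} zero {M} {N} {K} M≈K N≈K Kᵢ = begin
    altSum (λ j → K zero j * det (minor K j))
      ≈⟨ altSum-cong (λ j → begin
           K zero j * det (minor K j)                               ≈⟨ *-congʳ (Kᵢ j) ⟩
           (M zero j + N zero j) * det (minor K j)                  ≈⟨ distribʳ _ _ _ ⟩
           M zero j * det (minor K j) + N zero j * det (minor K j)
             ≈⟨ +-cong (*-congˡ (det-cong λ a b → sym (M≈K (suc a) (λ ()) _)))
                       (*-congˡ (det-cong λ a b → sym (N≈K (suc a) (λ ()) _))) ⟩
           M zero j * det (minor M j) + N zero j * det (minor N j)  ∎) ⟩
    altSum (λ j → M zero j * det (minor M j) + N zero j * det (minor N j))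
      ≈⟨ altSum-+ (λ j → M zero j * det (minor M j)) (λ j → N zero j * det (minor N j)) ⟩
    det M + det N ∎
  det-additiveInRow {suc n} (suc i) {M} {N} {K} M≈K N≈K Kᵢ = begin
    altSum (λ j → K zero j * det (minor K j))
      ≈⟨ altSum-cong (λ j → begin
           K zero j * det (minor K j)
             ≈⟨ *-congˡ (det-additiveInRow i (minor-sameOffRow M≈K j) (minor-sameOffRow N≈K j) (λ b → Kᵢ _)) ⟩
           K zero j * (det (minor M j) + det (minor N j))           ≈⟨ distribˡ _ _ _ ⟩
           K zero j * det (minor M j) + K zero j * det (minor N j)
             ≈⟨ +-cong (*-congʳ (sym (M≈K zero (λ ()) j))) (*-congʳ (sym (N≈K zero (λ ()) j))) ⟩
           M zero j * det (minor M j) + N zero j * det (minor N j)  ∎) ⟩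
    altSum (λ j → M zero j * det (minor M j) + N zero j * det (minor N j))
      ≈⟨ altSum-+ (λ j → M zero j * det (minor M j)) (λ j → N zero j * det (minor N j)) ⟩
    det M + det N ∎

  -- Matrices with two equal rows

  partner : ∀ {m} → Fin (suc m) → Fin m → Fin m
  partner {suc m} zero    _       = zero
  partner {suc m} (suc k) zero    = k
  partner {suc m} (suc k) (suc l) = suc (partner k l)

  punchIn-partner : ∀ {m} (k : Fin (suc m)) (l : Fin m) → punchIn (punchIn k l) (partner k l) ≡ k
  punchIn-partner {suc m} zero    l       = ≡.refl
  punchIn-partner {suc m} (suc k) zero    = ≡.refl
  punchIn-partner {suc m} (suc k) (suc l) = ≡.cong suc (punchIn-partner k l)

  punchIn-punchIn-partner : ∀ {m} (k : Fin (suc (suc m))) (l : Fin (suc m)) (c : Fin m) →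
                            punchIn k (punchIn l c) ≡ punchIn (punchIn k l) (punchIn (partner k l) c)
  punchIn-punchIn-partner zero    l       c       = ≡.refl
  punchIn-punchIn-partner (suc k) zero    c       = ≡.refl
  punchIn-punchIn-partner (suc k) (suc l) zero    = ≡.refl
  punchIn-punchIn-partner {suc m} (suc k) (suc l) (suc c) = ≡.cong suc (punchIn-punchIn-partner k l c)

  -- (k , l) ↦ (punchIn k l , partner k l) exchanges the two columns picked from a
  -- pair of rows; it reverses the sign with which the term enters the double sum.
  double-altSum-vanishes : ∀ m (F : Fin (suc m) → Fin m → Carrier) →
                           (∀ k l → F k l ≈ F (punchIn k l) (partner k l)) →
                           altSum (λ k → altSum (F k)) ≈ 0#
  double-altSum-vanishes zero    F F-inv = altSum-zero (λ k → altSum (F k)) λ _ → refl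
  double-altSum-vanishes (suc m) F F-inv = begin
    A + - altSum (λ k → F (suc k) zero + - altSum (F (suc k) ∘ suc))
      ≈⟨ +-congˡ (-‿cong (altSum-+ (λ k → F (suc k) zero) (λ k → - altSum (F (suc k) ∘ suc)))) ⟩
    A + - (altSum (λ k → F (suc k) zero) + altSum (λ k → - altSum (F (suc k) ∘ suc)))
      ≈⟨ +-congˡ (-‿cong (+-congˡ (altSum-neg (λ k → altSum (F (suc k) ∘ suc))))) ⟩
    A + - (altSum (λ k → F (suc k) zero) + - altSum (λ k → altSum (F (suc k) ∘ suc)))
      ≈⟨ +-congˡ (-‿cong (+-cong (altSum-cong λ k → F-inv (suc k) zero)
                                 (-‿cong (double-altSum-vanishes m _ λ k l → F-inv (suc k) (suc l))))) ⟩
    A + - (A + - 0#)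
      ≈⟨ +-congˡ (-‿cong (trans (+-congˡ -0#≈0#) (+-identityʳ A))) ⟩
    A + - A
      ≈⟨ -‿inverseʳ A ⟩
    0# ∎
    where A = altSum (F zero)

  det-equalRows₀₁ : ∀ {n} (M : Matrix (suc (suc n)) (suc (suc n))) →
                    (∀ b → M zero b ≈ M (suc zero) b) → det M ≈ 0#
  det-equalRows₀₁ {n} M M₀≈M₁ = begin
    altSum (λ k → M zero k * altSum (λ l → M (suc zero) (punchIn k l) * D k l))
      ≈⟨ altSum-cong (λ k → *-distribˡ-altSum (M zero k) (λ l → M (suc zero) (punchIn k l) * D k l)) ⟩
    altSum (λ k → altSum (F k))
      ≈⟨ double-altSum-vanishes (suc n) F F-inv ⟩
    0# ∎
    where
    D : Fin (suc (suc n)) → Fin (suc n) → Carrier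
    D k l = det λ a c → M (suc (suc a)) (punchIn k (punchIn l c))

    F : Fin (suc (suc n)) → Fin (suc n) → Carrier
    F k l = M zero k * (M (suc zero) (punchIn k l) * D k l)

    F-inv : ∀ k l → F k l ≈ F (punchIn k l) (partner k l)
    F-inv k l = begin
      M zero k * (M (suc zero) (punchIn k l) * D k l)
        ≈⟨ *-cong (M₀≈M₁ k) (*-cong (sym (M₀≈M₁ (punchIn k l)))
                  (det-cong λ a c → reflexive (≡.cong (M (suc (suc a))) (punchIn-punchIn-partner k l c)))) ⟩
      M (suc zero) k * (M zero (punchIn k l) * D (punchIn k l) (partner k l))
        ≈⟨ x∙yz≈y∙xz _ _ _ ⟩
      M zero (punchIn k l) * (M (suc zero) k * D (punchIn k l) (partner k l))
        ≈⟨ *-congˡ (*-congʳ (reflexive (≡.cong (M (suc zero)) (≡.sym (punchIn-partner k l))))) ⟩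
      F (punchIn k l) (partner k l) ∎

  module WithRows {n} (M : Matrix n n) (i j : Fin n) where

    withRows : (Fin n → Carrier) → (Fin n → Carrier) → Matrix n n
    withRows x y a b = if does (a ≟ i) then x b else if does (a ≟ j) then y b else M a b

    withRows-i : ∀ x y b → withRows x y i b ≡ x b
    withRows-i x y b rewrite dec-true (i ≟ i) ≡.refl = ≡.refl

    withRows-j : i ≢ j → ∀ x y b → withRows x y j b ≡ y b
    withRows-j i≢j x y b rewrite dec-false (j ≟ i) (i≢j ∘ ≡.sym) | dec-true (j ≟ j) ≡.refl = ≡.refl

    withRows-offᵢ : ∀ x x′ y → SameOffRow i (withRows x y) (withRows x′ y)
    withRows-offᵢ x x′ y a a≢i b rewrite dec-false (a ≟ i) a≢i = refl

    withRows-offⱼ : ∀ x y y′ → SameOffRow j (withRows x y) (withRows x y′)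
    withRows-offⱼ x y y′ a a≢j b with does (a ≟ i)
    ... | true  = refl
    ... | false rewrite dec-false (a ≟ j) a≢j = refl

    withRows-self : ∀ a b → withRows (M i) (M j) a b ≈ M a b
    withRows-self a b with a ≟ i
    ... | yes ≡.refl = refl
    ... | no _ with a ≟ j
    ...   | yes ≡.refl = refl
    ...   | no _       = refl

    -- Expand the determinant of the matrix with rows i and j both equal to x + y.
    det-withRows-antisym : i ≢ j → (∀ W → (∀ b → W i b ≈ W j b) → det W ≈ 0#) →
                           ∀ x y → det (withRows x y) + det (withRows y x) ≈ 0#
    det-withRows-antisym i≢j alternating x y = begin
      det (withRows x y) + det (withRows y x)
        ≈⟨ +-cong (+-identityˡ _) (+-identityʳ _) ⟨
      (0# + det (withRows x y)) + (det (withRows y x) + 0#)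
        ≈⟨ +-cong (+-congʳ (equal x)) (+-congˡ (equal y)) ⟨
      (det (withRows x x) + det (withRows x y)) + (det (withRows y x) + det (withRows y y))
        ≈⟨ +-cong (splitⱼ x) (splitⱼ y) ⟨
      det (withRows x s) + det (withRows y s)
        ≈⟨ det-additiveInRow i (withRows-offᵢ x s s) (withRows-offᵢ y s s) (λ b → reflexive (≡.trans
             (withRows-i s s b) (≡.sym (≡.cong₂ _+_ (withRows-i x s b) (withRows-i y s b))))) ⟨
      det (withRows s s)
        ≈⟨ equal s ⟩
      0# ∎
      where
      s : Fin n → Carrier
      s b = x b + y b

      equal : ∀ z → det (withRows z z) ≈ 0#
      equal z = alternating (withRows z z) λ b →
        reflexive (≡.trans (withRows-i z z b) (≡.sym (withRows-j i≢j z z b)))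

      splitⱼ : ∀ z → det (withRows z s) ≈ det (withRows z x) + det (withRows z y)
      splitⱼ z = det-additiveInRow j (withRows-offⱼ z x s) (withRows-offⱼ z y s) (λ b → reflexive (≡.trans
                   (withRows-j i≢j z s b) (≡.sym (≡.cong₂ _+_ (withRows-j i≢j z x b) (withRows-j i≢j z y b)))))

  det-equalRows : ∀ {n} (M : Matrix n n) {i j : Fin n} → i ≢ j → (∀ b → M i b ≈ M j b) → det M ≈ 0#
  det-equalRowsBelow₀ : ∀ {n} (M : Matrix (suc n) (suc n)) {i j : Fin n} → i ≢ j →
                        (∀ b → M (suc i) b ≈ M (suc j) b) → det M ≈ 0#
  det-equalRow₀ : ∀ {n} (M : Matrix (suc n) (suc n)) (j : Fin n) →
                  (∀ b → M zero b ≈ M (suc j) b) → det M ≈ 0#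

  det-equalRows {suc n} M {zero}  {zero}  0≢0 _     = ⊥-elim (0≢0 ≡.refl)
  det-equalRows {suc n} M {zero}  {suc j} _   M₀≈Mⱼ = det-equalRow₀ M j M₀≈Mⱼ
  det-equalRows {suc n} M {suc i} {zero}  _   Mᵢ≈M₀ = det-equalRow₀ M i (sym ∘ Mᵢ≈M₀)
  det-equalRows {suc n} M {suc i} {suc j} i≢j Mᵢ≈Mⱼ = det-equalRowsBelow₀ M (i≢j ∘ ≡.cong suc) Mᵢ≈Mⱼ

  det-equalRowsBelow₀ M i≢j Mᵢ≈Mⱼ = altSum-zero (λ k → M zero k * det (minor M k))
    λ k → trans (*-congˡ (det-equalRows (minor M k) i≢j λ b → Mᵢ≈Mⱼ _)) (zeroʳ _)

  det-equalRow₀ {suc n} M zero    M₀≈M₁ = det-equalRows₀₁ M M₀≈M₁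
  -- Exchanging rows 1 and j + 2 produces a matrix whose rows 0 and 1 agree.
  det-equalRow₀ {suc n} M (suc j) M₀≈Mⱼ = begin
    det M
      ≈⟨ det-cong withRows-self ⟨
    det (withRows (M (suc zero)) (M (suc (suc j))))
      ≈⟨ +-identityʳ _ ⟨
    det (withRows (M (suc zero)) (M (suc (suc j)))) + 0#
      ≈⟨ +-congˡ (det-equalRows₀₁ (withRows (M (suc (suc j))) (M (suc zero)))
                   λ b → trans (M₀≈Mⱼ b) (reflexive (≡.sym (withRows-i (M (suc (suc j))) (M (suc zero)) b)))) ⟨
    det (withRows (M (suc zero)) (M (suc (suc j)))) + det (withRows (M (suc (suc j))) (M (suc zero)))
      ≈⟨ det-withRows-antisym (λ ()) (λ W → det-equalRowsBelow₀ W (λ ())) (M (suc zero)) (M (suc (suc j))) ⟩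
    0# ∎
    where open WithRows M (suc zero) (suc (suc j))

  addLowerRows : ∀ {m k} → Matrix m k → Matrix (m ℕ.+ k) (m ℕ.+ k) → Matrix (m ℕ.+ k) (m ℕ.+ k)
  addLowerRows {m} {k} L M a b =
    [ (λ i → M a b + ∑[ r < k ] (L i r * M (m ↑ʳ r) b)) , (λ _ → M a b) ]′ (splitAt m a)

  minor-addLowerRows : ∀ {m k} (L : Matrix (suc m) k) M j a b →
                       minor (addLowerRows L M) j a b ≡ addLowerRows (L ∘ suc) (minor M j) a b
  minor-addLowerRows {m} L M j a b with splitAt m a
  ... | inj₁ _ = ≡.refl
  ... | inj₂ _ = ≡.refl

  altSum-sum : ∀ {m k} (f : Fin k → Fin m → Carrier) →
               altSum (λ j → ∑[ r < k ] f r j) ≈ ∑[ r < k ] altSum (f r)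
  altSum-sum {m} {zero}  f = altSum-zero {m} (λ _ → 0#) (λ _ → refl)
  altSum-sum {m} {suc k} f =
    trans (altSum-+ (f zero) (λ j → ∑[ r < k ] f (suc r) j)) (+-congˡ (altSum-sum (f ∘ suc)))

  -- Laplace expansion along row 0 is linear in that row, and a lower row put in
  -- place of row 0 contributes a determinant with two equal rows.
  det-addLowerRows : ∀ {m k} (L : Matrix m k) (M : Matrix (m ℕ.+ k) (m ℕ.+ k)) → det (addLowerRows L M) ≈ det M
  det-addLowerRows {zero}      L M = refl
  det-addLowerRows {suc m} {k} L M = begin
    altSum (λ j → row₀ j * det (minor (addLowerRows L M) j))
      ≈⟨ altSum-cong (λ j → *-congˡ {x = row₀ j} (trans (det-cong λ a b → reflexive (minor-addLowerRows L M j a b))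
                                                        (det-addLowerRows (L ∘ suc) (minor M j)))) ⟩
    altSum (λ j → row₀ j * d j)
      ≈⟨ altSum-cong (λ j → trans (distribʳ (d j) (M zero j) _) (+-congˡ (trans
           (*-distribʳ-sum (d j) (λ r → L zero r * lower r j))
           (sum-cong-≋ λ r → *-assoc (L zero r) (lower r j) (d j))))) ⟩
    altSum (λ j → M zero j * d j + ∑[ r < k ] (L zero r * (lower r j * d j)))
      ≈⟨ altSum-+ (λ j → M zero j * d j) (λ j → ∑[ r < k ] (L zero r * (lower r j * d j))) ⟩
    det M + altSum (λ j → ∑[ r < k ] (L zero r * (lower r j * d j)))
      ≈⟨ +-congˡ (altSum-sum λ r j → L zero r * (lower r j * d j)) ⟩
    det M + ∑[ r < k ] altSum (λ j → L zero r * (lower r j * d j))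
      ≈⟨ +-congˡ (sum-zero _ λ r → trans (sym (*-distribˡ-altSum (L zero r) (λ j → lower r j * d j)))
                                         (trans (*-congˡ (lowerRow-vanishes r)) (zeroʳ _))) ⟩
    det M + 0#
      ≈⟨ +-identityʳ _ ⟩
    det M ∎
    where
    lower : Fin k → Fin (suc m ℕ.+ k) → Carrier
    lower r = M (suc m ↑ʳ r)

    row₀ : Fin (suc m ℕ.+ k) → Carrier
    row₀ j = M zero j + ∑[ r < k ] (L zero r * lower r j)

    d : Fin (suc m ℕ.+ k) → Carrier
    d j = det (minor M j)

    lowerRow-vanishes : ∀ r → altSum (λ j → lower r j * d j) ≈ 0#
    lowerRow-vanishes r = det-equalRow₀ (λ { zero → lower r ; (suc a) → M (suc a) }) (m ↑ʳ r) (λ _ → refl)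

  -- Block matrices

  blockEntry : ∀ {m k} → Matrix m m → Matrix m k → Matrix k m → Matrix k k →
               Fin m ⊎ Fin k → Fin m ⊎ Fin k → Carrier
  blockEntry A B C D (inj₁ i) (inj₁ j) = A i j
  blockEntry A B C D (inj₁ i) (inj₂ j) = B i j
  blockEntry A B C D (inj₂ i) (inj₁ j) = C i j
  blockEntry A B C D (inj₂ i) (inj₂ j) = D i j

  blockMatrix : ∀ {m k} → Matrix m m → Matrix m k → Matrix k m → Matrix k k → Matrix (m ℕ.+ k) (m ℕ.+ k)
  blockMatrix {m} A B C D a b = blockEntry A B C D (splitAt m a) (splitAt m b)

  0ᴹ : ∀ {m k} → Matrix m k
  0ᴹ _ _ = 0#

  ↑ˡ≢↑ʳ : ∀ {m k} (i : Fin m) (j : Fin k) → i ↑ˡ k ≢ m ↑ʳ j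
  ↑ˡ≢↑ʳ {m} {k} i j eq with ≡.trans (≡.sym (splitAt-↑ˡ m i k)) (≡.trans (≡.cong (splitAt m) eq) (splitAt-↑ʳ m k j))
  ... | ()

  diagonal-join : ∀ {m k} x (s t : Fin m ⊎ Fin k) →
                  diagonal x (join m k s) (join m k t) ≡ blockEntry (diagonal x) 0ᴹ 0ᴹ (diagonal x) s t
  diagonal-join {m} {k} x (inj₁ i) (inj₁ j) =
    ≡.cong (λ b → if b then x else 0#) (does-⇔ (mk⇔ (↑ˡ-injective k i j) (≡.cong (_↑ˡ k))) (i ↑ˡ k ≟ j ↑ˡ k) (i ≟ j))
  diagonal-join {m} {k} x (inj₁ i) (inj₂ j) =
    ≡.cong (λ b → if b then x else 0#) (dec-false (i ↑ˡ k ≟ m ↑ʳ j) (↑ˡ≢↑ʳ i j))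
  diagonal-join {m} {k} x (inj₂ i) (inj₁ j) =
    ≡.cong (λ b → if b then x else 0#) (dec-false (m ↑ʳ i ≟ j ↑ˡ k) (↑ˡ≢↑ʳ j i ∘ ≡.sym))
  diagonal-join {m} {k} x (inj₂ i) (inj₂ j) =
    ≡.cong (λ b → if b then x else 0#) (does-⇔ (mk⇔ (↑ʳ-injective m i j) (≡.cong (m ↑ʳ_))) (m ↑ʳ i ≟ m ↑ʳ j) (i ≟ j))

  diagonal-blockMatrix : ∀ {m k} x (u v : Fin (m ℕ.+ k)) →
                         diagonal x u v ≡ blockMatrix {m} {k} (diagonal x) 0ᴹ 0ᴹ (diagonal x) u v
  diagonal-blockMatrix {m} {k} x u v = ≡.trans
    (≡.cong₂ (diagonal x) (≡.sym (join-splitAt m k u)) (≡.sym (join-splitAt m k v)))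
    (diagonal-join x (splitAt m u) (splitAt m v))

  splitAt-punchIn-↑ˡ : ∀ m k (i : Fin (suc m)) (c : Fin (m ℕ.+ k)) →
                       splitAt (suc m) (punchIn (i ↑ˡ k) c) ≡ map₁ (punchIn i) (splitAt m c)
  splitAt-punchIn-↑ˡ m       k zero    c       = ≡.refl
  splitAt-punchIn-↑ˡ (suc m) k (suc i) zero    = ≡.refl
  splitAt-punchIn-↑ˡ (suc m) k (suc i) (suc c) with splitAt m c | splitAt-punchIn-↑ˡ m k i c
  ... | inj₁ _ | eq = ≡.cong (map₁ suc) eq
  ... | inj₂ _ | eq = ≡.cong (map₁ suc) eq

  altSum-↑ˡ : ∀ m k (f : Fin (m ℕ.+ k) → Carrier) → (∀ r → f (m ↑ʳ r) ≈ 0#) →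
              altSum f ≈ altSum (λ i → f (i ↑ˡ k))
  altSum-↑ˡ zero    k f f≈0 = altSum-zero f f≈0
  altSum-↑ˡ (suc m) k f f≈0 = +-congˡ (-‿cong (altSum-↑ˡ m k (f ∘ suc) f≈0))

  det-blockLowerTriangular : ∀ {m k} (A : Matrix m m) (C : Matrix k m) (D : Matrix k k) →
                             det (blockMatrix A 0ᴹ C D) ≈ det A * det D
  det-blockLowerTriangular {zero}      A C D = sym (*-identityˡ _)
  det-blockLowerTriangular {suc m} {k} A C D = begin
    altSum (λ c → T zero c * det (minor T c))
      ≈⟨ altSum-↑ˡ (suc m) k (λ c → T zero c * det (minor T c)) (λ r → trans
           (*-congʳ (reflexive (≡.cong (blockEntry A 0ᴹ C D (inj₁ zero)) (splitAt-↑ʳ (suc m) k r)))) (zeroˡ _)) ⟩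
    altSum (λ i → T zero (i ↑ˡ k) * det (minor T (i ↑ˡ k)))
      ≈⟨ altSum-cong (λ i → *-cong (reflexive (≡.cong (blockEntry A 0ᴹ C D (inj₁ zero)) (splitAt-↑ˡ (suc m) i k)))
           (trans (det-cong λ a c → reflexive (minor-T i a c))
                  (det-blockLowerTriangular (minor A i) (λ a c → C a (punchIn i c)) D))) ⟩
    altSum (λ i → A zero i * (det (minor A i) * det D))
      ≈⟨ altSum-cong (λ i → trans (sym (*-assoc (A zero i) (det (minor A i)) (det D)))
                                  (*-comm (A zero i * det (minor A i)) (det D))) ⟩
    altSum (λ i → det D * (A zero i * det (minor A i)))
      ≈⟨ *-distribˡ-altSum (det D) (λ i → A zero i * det (minor A i)) ⟨
    det D * det A
      ≈⟨ *-comm _ _ ⟩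
    det A * det D ∎
    where
    T = blockMatrix A 0ᴹ C D

    minor-T : ∀ i a c → minor T (i ↑ˡ k) a c ≡ blockMatrix (minor A i) 0ᴹ (λ a c → C a (punchIn i c)) D a c
    minor-T i a c rewrite splitAt-punchIn-↑ˡ m k i c with splitAt m a | splitAt m c
    ... | inj₁ _ | inj₁ _ = ≡.refl
    ... | inj₁ _ | inj₂ _ = ≡.refl
    ... | inj₂ _ | inj₁ _ = ≡.refl
    ... | inj₂ _ | inj₂ _ = ≡.refl

  -- Permuting the columns cyclically

  rotate : ∀ {N} → Fin (suc N) → Fin (suc N)
  rotate {N} zero    = fromℕ N
  rotate     (suc c) = inject₁ c

  punchIn-fromℕ : ∀ {n} (k : Fin n) → punchIn (fromℕ n) k ≡ inject₁ k
  punchIn-fromℕ zero    = ≡.refl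
  punchIn-fromℕ (suc k) = ≡.cong suc (punchIn-fromℕ k)

  punchIn-inject₁-fromℕ : ∀ {n} (c : Fin (suc n)) → punchIn (inject₁ c) (fromℕ n) ≡ fromℕ (suc n)
  punchIn-inject₁-fromℕ         zero    = ≡.refl
  punchIn-inject₁-fromℕ {suc n} (suc c) = ≡.cong suc (punchIn-inject₁-fromℕ c)

  punchIn-inject₁ : ∀ {n} (c : Fin (suc n)) (k : Fin n) → punchIn (inject₁ c) (inject₁ k) ≡ inject₁ (punchIn c k)
  punchIn-inject₁ zero    k       = ≡.refl
  punchIn-inject₁ (suc c) zero    = ≡.refl
  punchIn-inject₁ (suc c) (suc k) = ≡.cong suc (punchIn-inject₁ c k)

  rotate-punchIn : ∀ {n} (c : Fin (suc n)) (k : Fin (suc n)) → rotate (punchIn (suc c) k) ≡ punchIn (inject₁ c) (rotate k)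
  rotate-punchIn c zero    = ≡.sym (punchIn-inject₁-fromℕ c)
  rotate-punchIn c (suc k) = ≡.sym (punchIn-inject₁ c k)

  altSum-init-last : ∀ {n} (f : Fin (suc n) → Carrier) → altSum f ≈ altSum (f ∘ inject₁) + (- 1#) ^ n * f (fromℕ n)
  altSum-init-last {zero}  f = begin
    f zero + - 0#      ≈⟨ +-congˡ -0#≈0# ⟩
    f zero + 0#        ≈⟨ +-identityʳ _ ⟩
    f zero             ≈⟨ *-identityˡ _ ⟨
    1# * f zero        ≈⟨ +-identityˡ _ ⟨
    0# + 1# * f zero   ∎
  altSum-init-last {suc n} f = begin
    f zero + - altSum (f ∘ suc)
      ≈⟨ +-congˡ (-‿cong (altSum-init-last (f ∘ suc))) ⟩
    f zero + - (altSum (f ∘ suc ∘ inject₁) + (- 1#) ^ n * f (fromℕ (suc n)))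
      ≈⟨ +-congˡ (-‿+-comm _ _) ⟨
    f zero + (- altSum (f ∘ suc ∘ inject₁) + - ((- 1#) ^ n * f (fromℕ (suc n))))
      ≈⟨ +-assoc _ _ _ ⟨
    (f zero + - altSum (f ∘ suc ∘ inject₁)) + - ((- 1#) ^ n * f (fromℕ (suc n)))
      ≈⟨ +-congˡ (trans (*-assoc (- 1#) _ _) (-1*x≈-x _)) ⟨
    (f zero + - altSum (f ∘ suc ∘ inject₁)) + (- 1#) ^ suc n * f (fromℕ (suc n)) ∎

  det-rotate : ∀ {N} (M : Matrix (suc N) (suc N)) → det (λ a c → M a (rotate c)) ≈ (- 1#) ^ N * det M
  det-rotate {zero}  M = sym (*-identityˡ _)
  det-rotate {suc N} M = begin
    M zero (fromℕ (suc N)) * det (λ a k → M (suc a) (inject₁ k))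
      + - altSum (λ c → M zero (inject₁ c) * det (λ a k → M (suc a) (rotate (punchIn (suc c) k))))
      ≈⟨ +-cong (*-congˡ (det-cong λ a k → reflexive (≡.cong (M (suc a)) (≡.sym (punchIn-fromℕ k)))))
                (-‿cong (altSum-cong λ c → *-congˡ {x = M zero (inject₁ c)} (trans
                   (det-cong λ a k → reflexive (≡.cong (M (suc a)) (rotate-punchIn c k)))
                   (det-rotate (minor M (inject₁ c)))))) ⟩
    last + - altSum (λ c → M zero (inject₁ c) * (s * det (minor M (inject₁ c))))
      ≈⟨ +-congˡ (-‿cong (trans (altSum-cong λ c → x∙yz≈y∙xz (M zero (inject₁ c)) s (det (minor M (inject₁ c))))
                                (sym (*-distribˡ-altSum s (T ∘ inject₁))))) ⟩
    last + - (s * init)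
      ≈⟨ +-comm _ _ ⟩
    - (s * init) + last
      ≈⟨ +-cong (trans (*-assoc (- 1#) s init) (-1*x≈-x _)) (trans (sym (*-assoc s′ s′ last))
                                                            (trans (*-congʳ (-1^-square (suc N))) (*-identityˡ last))) ⟨
    s′ * init + s′ * (s′ * last)
      ≈⟨ distribˡ s′ init (s′ * last) ⟨
    s′ * (init + s′ * last)
      ≈⟨ *-congˡ (altSum-init-last T) ⟨
    s′ * altSum T ∎
    where
    s s′ : Carrier
    s  = (- 1#) ^ N
    s′ = (- 1#) ^ suc N

    T : Fin (suc (suc N)) → Carrier
    T c = M zero c * det (minor M c)

    last init : Carrier
    last = T (fromℕ (suc N))
    init = altSum (T ∘ inject₁)

  rotate^ : ∀ {N} → ℕ → Fin (suc N) → Fin (suc N)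
  rotate^ zero    c = c
  rotate^ (suc t) c = rotate^ t (rotate c)

  det-rotate^ : ∀ {N} t (M : Matrix (suc N) (suc N)) → det (λ a c → M a (rotate^ t c)) ≈ (- 1#) ^ (t ℕ.* N) * det M
  det-rotate^     zero    M = sym (*-identityˡ _)
  det-rotate^ {N} (suc t) M = begin
    det (λ a c → M a (rotate^ t (rotate c)))           ≈⟨ det-rotate (λ a c → M a (rotate^ t c)) ⟩
    (- 1#) ^ N * det (λ a c → M a (rotate^ t c))       ≈⟨ *-congˡ (det-rotate^ t M) ⟩
    (- 1#) ^ N * ((- 1#) ^ (t ℕ.* N) * det M)          ≈⟨ *-assoc _ _ _ ⟨
    (- 1#) ^ N * (- 1#) ^ (t ℕ.* N) * det M            ≈⟨ *-congʳ (^-homo-* (- 1#) N (t ℕ.* N)) ⟨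
    (- 1#) ^ (N ℕ.+ t ℕ.* N) * det M                   ∎

  toℕ-rotate^-≥ : ∀ {N} t (c : Fin (suc N)) → t ≤ toℕ c → toℕ (rotate^ t c) ≡ toℕ c ∸ t
  toℕ-rotate^-≥ zero    c       _          = ≡.refl
  toℕ-rotate^-≥ (suc t) (suc c) (ℕ.s≤s t≤c) = ≡.trans
    (toℕ-rotate^-≥ t (inject₁ c) (≡.subst (t ≤_) (≡.sym (toℕ-inject₁ c)) t≤c))
    (≡.cong (_∸ t) (toℕ-inject₁ c))

  toℕ-rotate^-< : ∀ {N} t (c : Fin (suc N)) → toℕ c ℕ.< t → t ≤ suc N → toℕ (rotate^ t c) ≡ suc N ℕ.+ toℕ c ∸ t
  toℕ-rotate^-< {N} (suc t) zero    _             (ℕ.s≤s t≤N) = ≡.trans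
    (toℕ-rotate^-≥ t (fromℕ N) (≡.subst (t ≤_) (≡.sym (toℕ-fromℕ N)) t≤N))
    (≡.cong (_∸ t) (≡.trans (toℕ-fromℕ N) (≡.sym (ℕ.+-identityʳ N))))
  toℕ-rotate^-< {N} (suc t) (suc c) (ℕ.s≤s c<t) t<N = ≡.trans
    (toℕ-rotate^-< t (inject₁ c) (≡.subst (ℕ._< t) (≡.sym (toℕ-inject₁ c)) c<t) (ℕ.≤-trans (ℕ.n≤1+n t) t<N))
    (≡.trans (≡.cong (λ x → suc N ℕ.+ x ∸ t) (toℕ-inject₁ c)) (≡.sym (≡.cong (_∸ suc t) (ℕ.+-suc (suc N) (toℕ c)))))

  module _ (n′ : ℕ) where
    private
      n = suc n′

    rotate^-↑ˡ : ∀ (i : Fin n) → rotate^ n (i ↑ˡ n) ≡ n ↑ʳ i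
    rotate^-↑ˡ i = toℕ-injective (≡.trans
      (toℕ-rotate^-< n (i ↑ˡ n) (≡.subst (ℕ._< n) (≡.sym (toℕ-↑ˡ i n)) (toℕ<n i)) (ℕ.m≤m+n n n))
      (≡.trans (≡.cong (λ x → (n ℕ.+ n) ℕ.+ x ∸ n) (toℕ-↑ˡ i n))
      (≡.trans (≡.cong (_∸ n) (ℕ.+-assoc n n (toℕ i)))
      (≡.trans (ℕ.m+n∸m≡n n (n ℕ.+ toℕ i)) (≡.sym (toℕ-↑ʳ n i))))))

    rotate^-↑ʳ : ∀ (i : Fin n) → rotate^ n (n ↑ʳ i) ≡ i ↑ˡ n
    rotate^-↑ʳ i = toℕ-injective (≡.trans
      (toℕ-rotate^-≥ n (n ↑ʳ i) (≡.subst (n ≤_) (≡.sym (toℕ-↑ʳ n i)) (ℕ.m≤m+n n (toℕ i))))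
      (≡.trans (≡.cong (_∸ n) (toℕ-↑ʳ n i))
      (≡.trans (ℕ.m+n∸m≡n n (toℕ i)) (≡.sym (toℕ-↑ˡ i n)))))

    splitAt-rotate^ : ∀ c → splitAt n (rotate^ n c) ≡ swap (splitAt n c)
    splitAt-rotate^ c = ≡.trans (≡.cong (splitAt n ∘ rotate^ n) (≡.sym (join-splitAt n n c))) (onHalves (splitAt n c))
      where
      onHalves : ∀ s → splitAt n (rotate^ n (join n n s)) ≡ swap s
      onHalves (inj₁ i) = ≡.trans (≡.cong (splitAt n) (rotate^-↑ˡ i)) (splitAt-↑ʳ n n i)
      onHalves (inj₂ i) = ≡.trans (≡.cong (splitAt n) (rotate^-↑ʳ i)) (splitAt-↑ˡ n i n)

  det-swapColumnBlocks : ∀ {n} (A B C D : Matrix n n) →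
                         det (blockMatrix B A D C) ≈ (- 1#) ^ n * det (blockMatrix A B C D)
  det-swapColumnBlocks {zero}   A B C D = sym (*-identityˡ _)
  det-swapColumnBlocks {suc n′} A B C D = begin
    det (blockMatrix B A D C)
      ≈⟨ det-cong swapped ⟩
    det (λ a c → blockMatrix A B C D a (rotate^ n c))
      ≈⟨ det-rotate^ n (blockMatrix A B C D) ⟩
    (- 1#) ^ (n ℕ.* (n′ ℕ.+ n)) * det (blockMatrix A B C D)
      ≈⟨ *-congʳ (-1^-parity {n ℕ.* (n′ ℕ.+ n)} {n} {n ℕ.* n} sign-exponent) ⟩
    (- 1#) ^ n * det (blockMatrix A B C D) ∎
    where
    n = suc n′

    sign-exponent : n ℕ.* (n′ ℕ.+ n) ℕ.+ n ≡ n ℕ.* n ℕ.+ n ℕ.* n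
    sign-exponent = ≡.trans (ℕ.+-comm (n ℕ.* (n′ ℕ.+ n)) n)
                            (≡.trans (≡.sym (ℕ.*-suc n (n′ ℕ.+ n))) (ℕ.*-distribˡ-+ n n n))

    swapped : ∀ a c → blockMatrix B A D C a c ≈ blockMatrix A B C D a (rotate^ n c)
    swapped a c rewrite splitAt-rotate^ n′ c with splitAt n a | splitAt n c
    ... | inj₁ _ | inj₁ _ = refl
    ... | inj₁ _ | inj₂ _ = refl
    ... | inj₂ _ | inj₁ _ = refl
    ... | inj₂ _ | inj₂ _ = refl

  -- Matrix products and the Schur complement

  _*ᴹ_ : ∀ {n} → Matrix n n → Matrix n n → Matrix n n
  (_*ᴹ_ {n} M N) i j = ∑[ k < n ] (M i k * N k j)

  sum-*-diagonal : ∀ {n} (f : Fin n → Carrier) x j → ∑[ k < n ] (f k * diagonal x k j) ≈ f j * x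
  sum-*-diagonal {suc n} f x zero    = trans (+-congˡ (sum-zero _ λ k → zeroʳ (f (suc k)))) (+-identityʳ _)
  sum-*-diagonal {suc n} f x (suc j) = trans (+-cong (zeroʳ (f zero)) (sum-*-diagonal (f ∘ suc) x j)) (+-identityˡ _)

  sum-diagonal-* : ∀ {n} x i (f : Fin n → Carrier) → ∑[ k < n ] (diagonal x i k * f k) ≈ x * f i
  sum-diagonal-* {suc n} x zero    f = trans (+-congˡ (sum-zero _ λ k → zeroˡ (f (suc k)))) (+-identityʳ _)
  sum-diagonal-* {suc n} x (suc i) f = trans (+-cong (zeroˡ (f zero)) (sum-diagonal-* x i (f ∘ suc))) (+-identityˡ _)

  det-diagonal : ∀ {n} x → det {n} (diagonal x) ≈ x ^ n
  det-diagonal {zero}  x = refl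
  det-diagonal {suc n} x = begin
    x * det {n} (diagonal x) + - altSum {n} (λ j → 0# * det (minor (diagonal x) (suc j)))
      ≈⟨ +-cong (*-congˡ (det-diagonal {n} x))
                (-‿cong (altSum-zero {n} (λ j → 0# * det (minor (diagonal x) (suc j))) λ j → zeroˡ _)) ⟩
    x * x ^ n + - 0#    ≈⟨ +-congˡ -0#≈0# ⟩
    x * x ^ n + 0#      ≈⟨ +-identityʳ _ ⟩
    x * x ^ n           ∎

  -- The rows of the lower half, weighted by P, clear the upper-left block.
  det-schur : ∀ {n} (P E Q : Matrix n n) →
              det (blockMatrix P E (diagonal (- 1#)) Q) ≈ det (λ i j → (P *ᴹ Q) i j + E i j)
  det-schur {n} P E Q = begin
    det (blockMatrix P E -I Q)                      ≈⟨ det-addLowerRows P (blockMatrix P E -I Q) ⟨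
    det (addLowerRows P (blockMatrix P E -I Q))     ≈⟨ det-cong eliminated ⟩
    det (blockMatrix 0ᴹ W -I Q)                     ≈⟨ det-swapColumnBlocks W 0ᴹ Q -I ⟩
    (- 1#) ^ n * det (blockMatrix W 0ᴹ Q -I)        ≈⟨ *-congˡ (det-blockLowerTriangular W Q -I) ⟩
    (- 1#) ^ n * (det W * det -I)                   ≈⟨ *-congˡ (*-congˡ (det-diagonal {n} (- 1#))) ⟩
    (- 1#) ^ n * (det W * (- 1#) ^ n)               ≈⟨ x∙yz≈y∙xz _ _ _ ⟩
    det W * ((- 1#) ^ n * (- 1#) ^ n)               ≈⟨ *-congˡ (-1^-square n) ⟩
    det W * 1#                                      ≈⟨ *-identityʳ _ ⟩
    det W                                           ∎
    where
    -I W : Matrix n n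
    -I = diagonal (- 1#)
    W i j = (P *ᴹ Q) i j + E i j

    upperRow : ∀ i t → blockEntry P E -I Q (inj₁ i) t + ∑[ r < n ] (P i r * blockEntry P E -I Q (inj₂ r) t)
                       ≈ blockEntry 0ᴹ W -I Q (inj₁ i) t
    upperRow i (inj₁ j) = begin
      P i j + ∑[ r < n ] (P i r * -I r j) ≈⟨ +-congˡ (sum-*-diagonal (P i) (- 1#) j) ⟩
      P i j + P i j * - 1#               ≈⟨ +-congˡ (trans (*-comm _ _) (-1*x≈-x _)) ⟩
      P i j + - P i j                    ≈⟨ -‿inverseʳ _ ⟩
      0#                                 ∎
    upperRow i (inj₂ j) = +-comm _ _

    eliminated : ∀ a b → addLowerRows P (blockMatrix P E -I Q) a b ≈ blockMatrix 0ᴹ W -I Q a b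
    eliminated a b with splitAt n a | splitAt n b
    ... | inj₂ _ | inj₁ _ = refl
    ... | inj₂ _ | inj₂ _ = refl
    ... | inj₁ i | t      = trans (+-congˡ (sum-cong-≋ λ r → *-congˡ (reflexive
                              (≡.cong (λ s → blockEntry P E -I Q s t) (splitAt-↑ʳ n n r)))))
                              (upperRow i t)

  det-* : ∀ {n} (P Q : Matrix n n) → det P * det Q ≈ det (P *ᴹ Q)
  det-* {n} P Q = begin
    det P * det Q                                    ≈⟨ det-blockLowerTriangular P (diagonal (- 1#)) Q ⟨
    det (blockMatrix P 0ᴹ (diagonal (- 1#)) Q)       ≈⟨ det-schur P 0ᴹ Q ⟩
    det (λ i j → (P *ᴹ Q) i j + 0#)                  ≈⟨ det-cong {n} (λ i j → +-identityʳ _) ⟩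
    det (P *ᴹ Q)                                     ∎

  det-neg : ∀ {n} (M : Matrix n n) → det (λ i j → - M i j) ≈ (- 1#) ^ n * det M
  det-neg {zero}  M = sym (*-identityˡ _)
  det-neg {suc n} M = begin
    altSum (λ j → - M zero j * det (λ a k → - M (suc a) (punchIn j k)))
      ≈⟨ altSum-cong (λ j → *-congˡ {x = - M zero j} (det-neg (minor M j))) ⟩
    altSum (λ j → - M zero j * ((- 1#) ^ n * det (minor M j)))
      ≈⟨ altSum-cong (λ j → begin
           - M zero j * ((- 1#) ^ n * det (minor M j))    ≈⟨ -‿distribˡ-* _ _ ⟨
           - (M zero j * ((- 1#) ^ n * det (minor M j)))  ≈⟨ -‿cong (x∙yz≈y∙xz _ _ _) ⟩
           - ((- 1#) ^ n * (M zero j * det (minor M j)))  ≈⟨ -1*x≈-x _ ⟨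
           - 1# * ((- 1#) ^ n * (M zero j * det (minor M j))) ≈⟨ *-assoc _ _ _ ⟨
           (- 1#) ^ suc n * (M zero j * det (minor M j))  ∎) ⟩
    altSum (λ j → (- 1#) ^ suc n * (M zero j * det (minor M j)))
      ≈⟨ *-distribˡ-altSum ((- 1#) ^ suc n) (λ j → M zero j * det (minor M j)) ⟨
    (- 1#) ^ suc n * det M ∎

  *ᴹ-differenceOfSquares : ∀ {n} x (B : Matrix n n) i j →
    ∑[ k < n ] ((diagonal x i k + - B i k) * (diagonal x k j + B k j)) ≈ diagonal (x * x) i j + - (B *ᴹ B) i j
  *ᴹ-differenceOfSquares {n} x B i j = begin
    ∑[ k < n ] ((diagonal x i k + - B i k) * (diagonal x k j + B k j))
      ≈⟨ sum-cong-≋ (λ k → distribʳ (diagonal x k j + B k j) (diagonal x i k) (- B i k)) ⟩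
    ∑[ k < n ] (diagonal x i k * (diagonal x k j + B k j) + - B i k * (diagonal x k j + B k j))
      ≈⟨ ∑-distrib-+ (λ k → diagonal x i k * (diagonal x k j + B k j)) (λ k → - B i k * (diagonal x k j + B k j)) ⟩
    ∑[ k < n ] (diagonal x i k * (diagonal x k j + B k j)) + ∑[ k < n ] (- B i k * (diagonal x k j + B k j))
      ≈⟨ +-cong (sum-diagonal-* x i (λ k → diagonal x k j + B k j))
                (sum-cong-≋ λ k → trans (distribˡ (- B i k) (diagonal x k j) (B k j))
                                        (+-congˡ (sym (-‿distribˡ-* (B i k) (B k j))))) ⟩
    x * (diagonal x i j + B i j) + ∑[ k < n ] (- B i k * diagonal x k j + - (B i k * B k j))
      ≈⟨ +-cong (distribˡ x (diagonal x i j) (B i j))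
                (trans (∑-distrib-+ (λ k → - B i k * diagonal x k j) (λ k → - (B i k * B k j)))
                       (+-cong (sum-*-diagonal (λ k → - B i k) x j) (sum-neg (λ k → B i k * B k j)))) ⟩
    (x * diagonal x i j + x * B i j) + (- B i j * x + - (B *ᴹ B) i j)
      ≈⟨ +-assoc _ _ _ ⟩
    x * diagonal x i j + (x * B i j + (- B i j * x + - (B *ᴹ B) i j))
      ≈⟨ +-congˡ (+-assoc _ _ _) ⟨
    x * diagonal x i j + ((x * B i j + - B i j * x) + - (B *ᴹ B) i j)
      ≈⟨ +-cong (x*diagonal x i j) (+-congʳ cancel) ⟩
    diagonal (x * x) i j + (0# + - (B *ᴹ B) i j)
      ≈⟨ +-congˡ (+-identityˡ _) ⟩
    diagonal (x * x) i j + - (B *ᴹ B) i j ∎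
    where
    cancel : x * B i j + - B i j * x ≈ 0#
    cancel = trans (+-congˡ (trans (sym (-‿distribˡ-* (B i j) x)) (-‿cong (*-comm (B i j) x)))) (-‿inverseʳ _)

    x*diagonal : ∀ {n} x (i j : Fin n) → x * diagonal x i j ≈ diagonal (x * x) i j
    x*diagonal x i j with does (i ≟ j)
    ... | true  = refl
    ... | false = zeroʳ x

    sum-neg : ∀ {m} (f : Fin m → Carrier) → ∑[ k < m ] (- f k) ≈ - ∑[ k < m ] f k
    sum-neg {zero}  f = sym -0#≈0#
    sum-neg {suc m} f = trans (+-congˡ (sum-neg (f ∘ suc))) (-‿+-comm _ _)

module RingHomomorphism
  {c₁ ℓ₁ c₂ ℓ₂} (R₁ : CommutativeRing c₁ ℓ₁) (R₂ : CommutativeRing c₂ ℓ₂)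
  {f : CommutativeRing.Carrier R₁ → CommutativeRing.Carrier R₂}
  (isRingHomomorphism : IsRingHomomorphism (CommutativeRing.rawRing R₁) (CommutativeRing.rawRing R₂) f)
  where

  open import Data.Fin.Base using (Fin; zero; suc)
  open import Data.Nat.Base using (zero; suc)
  open import Function.Base using (_∘_)

  private
    module D₁ = Determinant R₁
    module R₁ = CommutativeRing R₁
  open Determinant R₂
  open CommutativeRing R₂ hiding (zero)
  open IsRingHomomorphism isRingHomomorphism

  homo-altSum : ∀ {m} (g : Fin m → R₁.Carrier) → f (D₁.altSum g) ≈ altSum (f ∘ g)
  homo-altSum {zero}  g = 0#-homo
  homo-altSum {suc m} g = trans (+-homo _ _) (+-congˡ (trans (-‿homo _) (-‿cong (homo-altSum (g ∘ suc)))))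

  homo-sum : ∀ {m} (g : Fin m → R₁.Carrier) → f (D₁.sum g) ≈ sum (f ∘ g)
  homo-sum {zero}  g = 0#-homo
  homo-sum {suc m} g = trans (+-homo _ _) (+-congˡ (homo-sum (g ∘ suc)))

  homo-det : ∀ {n} (M : D₁.Matrix n n) → f (D₁.det M) ≈ det (λ i j → f (M i j))
  homo-det {zero}  M = 1#-homo
  homo-det {suc n} M = trans (homo-altSum (λ j → M zero j R₁.* D₁.det (D₁.minor M j)))
    (altSum-cong λ j → trans (*-homo (M zero j) _) (*-congˡ (homo-det (D₁.minor M j))))

  homo-^ : ∀ x k → f (x D₁.^ k) ≈ f x ^ k
  homo-^ x zero    = 1#-homo
  homo-^ x (suc k) = trans (*-homo _ _) (*-congˡ (homo-^ x k))

  homo-product : ∀ {m} (g : Fin m → R₁.Carrier) → f (D₁.product g) ≈ product (f ∘ g)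
  homo-product {zero}  g = 1#-homo
  homo-product {suc m} g = trans (*-homo _ _) (*-congˡ (homo-product (g ∘ suc)))

module Polynomial {c ℓ} (R : CommutativeRing c ℓ) where

  open import Algebra.Structures using (IsCommutativeRing)
  open import Relation.Binary.Bundles using (Setoid)
  import Relation.Binary.Reasoning.Setoid
  open import Data.List.Base as List using ([]; _∷_)
  open import Data.Nat.Base using (zero; suc)
  open import Data.Product.Base using (_,_)
  open import Function.Base using (_∘_)
  open import Relation.Binary.PropositionalEquality as ≡ using (_≡_)

  open Poly R public

  open CommutativeRing R hiding (zero)
  open import Algebra.Properties.Ring ring using (-0#≈0#)
  open import Algebra.Properties.CommutativeSemigroup +-commutativeSemigroup using (interchange; x∙yz≈y∙xz)

  scale : Carrier → Pol → Pol
  scale a = List.map (a *_)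

  coeff-+ₚ : ∀ p q k → coeff (p +ₚ q) k ≈ coeff p k + coeff q k
  coeff-+ₚ []      q       k       = sym (+-identityˡ _)
  coeff-+ₚ (a ∷ p) []      k       = sym (+-identityʳ _)
  coeff-+ₚ (a ∷ p) (b ∷ q) zero    = refl
  coeff-+ₚ (a ∷ p) (b ∷ q) (suc k) = coeff-+ₚ p q k

  coeff--ₚ : ∀ p k → coeff (-ₚ p) k ≈ - coeff p k
  coeff--ₚ []      k       = sym -0#≈0#
  coeff--ₚ (a ∷ p) zero    = refl
  coeff--ₚ (a ∷ p) (suc k) = coeff--ₚ p k

  coeff-scale : ∀ a p k → coeff (scale a p) k ≈ a * coeff p k
  coeff-scale a []      k       = sym (zeroʳ a)
  coeff-scale a (b ∷ p) zero    = refl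
  coeff-scale a (b ∷ p) (suc k) = coeff-scale a p k

  -- Coefficientwise equality, wrapped in a record so that it determines the
  -- polynomials it relates.
  infix 4 _≋_
  record _≋_ (p q : Pol) : Set ℓ where
    constructor ≈ₚ⇒≋
    field ≋⇒≈ₚ : p ≈ₚ q
  open _≋_ public

  ≋-setoid : Setoid c ℓ
  ≋-setoid = record
    { Carrier       = Pol
    ; _≈_           = _≋_
    ; isEquivalence = record
      { refl  = ≈ₚ⇒≋ λ k → refl
      ; sym   = λ (≈ₚ⇒≋ p≈q) → ≈ₚ⇒≋ λ k → sym (p≈q k)
      ; trans = λ (≈ₚ⇒≋ p≈q) (≈ₚ⇒≋ q≈r) → ≈ₚ⇒≋ λ k → trans (p≈q k) (q≈r k)
      }
    }

  open Setoid ≋-setoid public using () renaming (refl to ≋-refl; sym to ≋-sym; trans to ≋-trans; reflexive to ≋-reflexive)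
  module ≋-Reasoning = Relation.Binary.Reasoning.Setoid ≋-setoid

  ∷-cong : ∀ {a b p q} → a ≈ b → p ≋ q → (a ∷ p) ≋ (b ∷ q)
  ∷-cong a≈b (≈ₚ⇒≋ p≈q) = ≈ₚ⇒≋ λ { zero → a≈b ; (suc k) → p≈q k }

  ∷-tail : ∀ {a b p q} → (a ∷ p) ≋ (b ∷ q) → p ≋ q
  ∷-tail (≈ₚ⇒≋ a∷p≈b∷q) = ≈ₚ⇒≋ (a∷p≈b∷q ∘ suc)

  ∷≋[]-tail : ∀ {a p} → (a ∷ p) ≋ [] → p ≋ []
  ∷≋[]-tail (≈ₚ⇒≋ a∷p≈0) = ≈ₚ⇒≋ (a∷p≈0 ∘ suc)

  [0#]≋[] : (0# ∷ []) ≋ []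
  [0#]≋[] = ≈ₚ⇒≋ λ { zero → refl ; (suc k) → refl }

  +ₚ-cong : ∀ {p p′ q q′} → p ≋ p′ → q ≋ q′ → p +ₚ q ≋ p′ +ₚ q′
  +ₚ-cong {p} {p′} {q} {q′} (≈ₚ⇒≋ p≈p′) (≈ₚ⇒≋ q≈q′) = ≈ₚ⇒≋ λ k →
    trans (coeff-+ₚ p q k) (trans (+-cong (p≈p′ k) (q≈q′ k)) (sym (coeff-+ₚ p′ q′ k)))

  -ₚ-cong : ∀ {p p′} → p ≋ p′ → -ₚ p ≋ -ₚ p′
  -ₚ-cong {p} {p′} (≈ₚ⇒≋ p≈p′) = ≈ₚ⇒≋ λ k → trans (coeff--ₚ p k) (trans (-‿cong (p≈p′ k)) (sym (coeff--ₚ p′ k)))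

  scale-cong : ∀ {a b p q} → a ≈ b → p ≋ q → scale a p ≋ scale b q
  scale-cong {a} {b} {p} {q} a≈b (≈ₚ⇒≋ p≈q) = ≈ₚ⇒≋ λ k →
    trans (coeff-scale a p k) (trans (*-cong a≈b (p≈q k)) (sym (coeff-scale b q k)))

  +ₚ-assoc : ∀ p q r → (p +ₚ q) +ₚ r ≋ p +ₚ (q +ₚ r)
  +ₚ-assoc p q r = ≈ₚ⇒≋ λ k → begin
    coeff ((p +ₚ q) +ₚ r) k               ≈⟨ trans (coeff-+ₚ (p +ₚ q) r k) (+-congʳ (coeff-+ₚ p q k)) ⟩
    (coeff p k + coeff q k) + coeff r k   ≈⟨ +-assoc _ _ _ ⟩
    coeff p k + (coeff q k + coeff r k)   ≈⟨ trans (coeff-+ₚ p (q +ₚ r) k) (+-congˡ (coeff-+ₚ q r k)) ⟨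
    coeff (p +ₚ (q +ₚ r)) k               ∎
    where open import Relation.Binary.Reasoning.Setoid setoid

  +ₚ-comm : ∀ p q → p +ₚ q ≋ q +ₚ p
  +ₚ-comm p q = ≈ₚ⇒≋ λ k → trans (coeff-+ₚ p q k) (trans (+-comm _ _) (sym (coeff-+ₚ q p k)))

  +ₚ-identityʳ : ∀ p → p +ₚ [] ≋ p
  +ₚ-identityʳ p = ≈ₚ⇒≋ λ k → trans (coeff-+ₚ p [] k) (+-identityʳ _)

  -ₚ-inverseˡ : ∀ p → (-ₚ p) +ₚ p ≋ []
  -ₚ-inverseˡ p = ≈ₚ⇒≋ λ k → trans (coeff-+ₚ (-ₚ p) p k) (trans (+-congʳ (coeff--ₚ p k)) (-‿inverseˡ _))

  -ₚ-inverseʳ : ∀ p → p +ₚ (-ₚ p) ≋ []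
  -ₚ-inverseʳ p = ≈ₚ⇒≋ λ k → trans (coeff-+ₚ p (-ₚ p) k) (trans (+-congˡ (coeff--ₚ p k)) (-‿inverseʳ _))

  +ₚ-leftComm : ∀ p q r → p +ₚ (q +ₚ r) ≋ q +ₚ (p +ₚ r)
  +ₚ-leftComm p q r = ≈ₚ⇒≋ λ k → begin
    coeff (p +ₚ (q +ₚ r)) k               ≈⟨ trans (coeff-+ₚ p (q +ₚ r) k) (+-congˡ (coeff-+ₚ q r k)) ⟩
    coeff p k + (coeff q k + coeff r k)   ≈⟨ x∙yz≈y∙xz _ _ _ ⟩
    coeff q k + (coeff p k + coeff r k)   ≈⟨ trans (coeff-+ₚ q (p +ₚ r) k) (+-congˡ (coeff-+ₚ p r k)) ⟨
    coeff (q +ₚ (p +ₚ r)) k               ∎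
    where open import Relation.Binary.Reasoning.Setoid setoid

  +ₚ-interchange : ∀ p q r s → (p +ₚ q) +ₚ (r +ₚ s) ≋ (p +ₚ r) +ₚ (q +ₚ s)
  +ₚ-interchange p q r s = ≈ₚ⇒≋ λ k → begin
    coeff ((p +ₚ q) +ₚ (r +ₚ s)) k
      ≈⟨ trans (coeff-+ₚ (p +ₚ q) (r +ₚ s) k) (+-cong (coeff-+ₚ p q k) (coeff-+ₚ r s k)) ⟩
    (coeff p k + coeff q k) + (coeff r k + coeff s k)
      ≈⟨ interchange _ _ _ _ ⟩
    (coeff p k + coeff r k) + (coeff q k + coeff s k)
      ≈⟨ trans (coeff-+ₚ (p +ₚ r) (q +ₚ s) k) (+-cong (coeff-+ₚ p r k) (coeff-+ₚ q s k)) ⟨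
    coeff ((p +ₚ r) +ₚ (q +ₚ s)) k ∎
    where open import Relation.Binary.Reasoning.Setoid setoid

  scale-+ₚ : ∀ a p q → scale a (p +ₚ q) ≋ scale a p +ₚ scale a q
  scale-+ₚ a p q = ≈ₚ⇒≋ λ k → begin
    coeff (scale a (p +ₚ q)) k          ≈⟨ trans (coeff-scale a (p +ₚ q) k) (*-congˡ (coeff-+ₚ p q k)) ⟩
    a * (coeff p k + coeff q k)         ≈⟨ distribˡ a _ _ ⟩
    a * coeff p k + a * coeff q k       ≈⟨ trans (coeff-+ₚ (scale a p) (scale a q) k) (+-cong (coeff-scale a p k) (coeff-scale a q k)) ⟨
    coeff (scale a p +ₚ scale a q) k    ∎
    where open import Relation.Binary.Reasoning.Setoid setoid

  scale-zero : ∀ {a} p → a ≈ 0# → scale a p ≋ []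
  scale-zero {a} p a≈0 = ≈ₚ⇒≋ λ k → trans (coeff-scale a p k) (trans (*-congʳ a≈0) (zeroˡ _))

  scale-one : ∀ p → scale 1# p ≋ p
  scale-one p = ≈ₚ⇒≋ λ k → trans (coeff-scale 1# p k) (*-identityˡ _)

  scale-scale : ∀ a b p → scale (a * b) p ≋ scale a (scale b p)
  scale-scale a b p = ≈ₚ⇒≋ λ k →
    trans (coeff-scale (a * b) p k) (trans (*-assoc a b _) (sym (trans (coeff-scale a (scale b p) k) (*-congˡ (coeff-scale b p k)))))

  *ₚ-zeroʳ : ∀ p → p *ₚ [] ≋ []
  *ₚ-zeroʳ []      = ≋-refl
  *ₚ-zeroʳ (a ∷ p) = ≋-trans (∷-cong refl (*ₚ-zeroʳ p)) [0#]≋[]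

  *ₚ-annihilatedˡ : ∀ {p} q → p ≋ [] → p *ₚ q ≋ []
  *ₚ-annihilatedˡ {[]}    q p≈0 = ≋-refl
  *ₚ-annihilatedˡ {a ∷ p} q p≈0 = +ₚ-cong (scale-zero q (≋⇒≈ₚ p≈0 zero))
    (≋-trans (∷-cong refl (*ₚ-annihilatedˡ q (∷≋[]-tail p≈0))) [0#]≋[])

  *ₚ-congʳ : ∀ p {q q′} → q ≋ q′ → p *ₚ q ≋ p *ₚ q′
  *ₚ-congʳ []      q≈q′ = ≋-refl
  *ₚ-congʳ (a ∷ p) q≈q′ = +ₚ-cong (scale-cong refl q≈q′) (∷-cong refl (*ₚ-congʳ p q≈q′))

  *ₚ-congˡ : ∀ {p p′} q → p ≋ p′ → p *ₚ q ≋ p′ *ₚ q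
  *ₚ-congˡ {[]}    {p′}     q p≈p′ = ≋-sym (*ₚ-annihilatedˡ q (≋-sym p≈p′))
  *ₚ-congˡ {a ∷ p} {[]}     q p≈p′ = *ₚ-annihilatedˡ q p≈p′
  *ₚ-congˡ {a ∷ p} {b ∷ p′} q p≈p′ =
    +ₚ-cong (scale-cong (≋⇒≈ₚ p≈p′ zero) ≋-refl) (∷-cong refl (*ₚ-congˡ q (∷-tail p≈p′)))

  *ₚ-cong : ∀ {p p′ q q′} → p ≋ p′ → q ≋ q′ → p *ₚ q ≋ p′ *ₚ q′
  *ₚ-cong {p′ = p′} {q} p≈p′ q≈q′ = ≋-trans (*ₚ-congˡ q p≈p′) (*ₚ-congʳ p′ q≈q′)

  *ₚ-∷ʳ : ∀ p a q → p *ₚ (a ∷ q) ≋ scale a p +ₚ (0# ∷ (p *ₚ q))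
  *ₚ-∷ʳ []      a q = ≋-sym [0#]≋[]
  *ₚ-∷ʳ (b ∷ p) a q = ∷-cong (+-congʳ (*-comm b a)) (begin
    scale b q +ₚ p *ₚ (a ∷ q)                     ≈⟨ +ₚ-cong ≋-refl (*ₚ-∷ʳ p a q) ⟩
    scale b q +ₚ (scale a p +ₚ (0# ∷ (p *ₚ q)))   ≈⟨ +ₚ-leftComm (scale b q) (scale a p) _ ⟩
    scale a p +ₚ (scale b q +ₚ (0# ∷ (p *ₚ q)))   ∎)
    where open ≋-Reasoning

  *ₚ-comm : ∀ p q → p *ₚ q ≋ q *ₚ p
  *ₚ-comm []      q = ≋-sym (*ₚ-zeroʳ q)
  *ₚ-comm (a ∷ p) q = ≋-trans (+ₚ-cong ≋-refl (∷-cong refl (*ₚ-comm p q))) (≋-sym (*ₚ-∷ʳ q a p))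

  *ₚ-distribˡ : ∀ p q r → p *ₚ (q +ₚ r) ≋ p *ₚ q +ₚ p *ₚ r
  *ₚ-distribˡ []      q r = ≋-refl
  *ₚ-distribˡ (a ∷ p) q r = begin
    scale a (q +ₚ r) +ₚ (0# ∷ p *ₚ (q +ₚ r))
      ≈⟨ +ₚ-cong (scale-+ₚ a q r) (∷-cong (sym (+-identityʳ 0#)) (*ₚ-distribˡ p q r)) ⟩
    (scale a q +ₚ scale a r) +ₚ ((0# ∷ p *ₚ q) +ₚ (0# ∷ p *ₚ r))
      ≈⟨ +ₚ-interchange (scale a q) (scale a r) _ _ ⟩
    (scale a q +ₚ (0# ∷ p *ₚ q)) +ₚ (scale a r +ₚ (0# ∷ p *ₚ r)) ∎
    where open ≋-Reasoning

  *ₚ-distribʳ : ∀ p q r → (q +ₚ r) *ₚ p ≋ q *ₚ p +ₚ r *ₚ p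
  *ₚ-distribʳ p q r = begin
    (q +ₚ r) *ₚ p       ≈⟨ *ₚ-comm (q +ₚ r) p ⟩
    p *ₚ (q +ₚ r)       ≈⟨ *ₚ-distribˡ p q r ⟩
    p *ₚ q +ₚ p *ₚ r    ≈⟨ +ₚ-cong (*ₚ-comm p q) (*ₚ-comm p r) ⟩
    q *ₚ p +ₚ r *ₚ p    ∎
    where open ≋-Reasoning

  scale-*ₚ : ∀ a p q → scale a p *ₚ q ≋ scale a (p *ₚ q)
  scale-*ₚ a []      q = ≋-refl
  scale-*ₚ a (b ∷ p) q = begin
    scale (a * b) q +ₚ (0# ∷ scale a p *ₚ q)
      ≈⟨ +ₚ-cong (scale-scale a b q) (∷-cong (sym (zeroʳ a)) (scale-*ₚ a p q)) ⟩
    scale a (scale b q) +ₚ scale a (0# ∷ p *ₚ q)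
      ≈⟨ scale-+ₚ a (scale b q) _ ⟨
    scale a (scale b q +ₚ (0# ∷ p *ₚ q)) ∎
    where open ≋-Reasoning

  *ₚ-assoc : ∀ p q r → (p *ₚ q) *ₚ r ≋ p *ₚ (q *ₚ r)
  *ₚ-assoc []      q r = ≋-refl
  *ₚ-assoc (a ∷ p) q r = begin
    (scale a q +ₚ (0# ∷ p *ₚ q)) *ₚ r
      ≈⟨ *ₚ-distribʳ r (scale a q) _ ⟩
    scale a q *ₚ r +ₚ (scale 0# r +ₚ (0# ∷ (p *ₚ q) *ₚ r))
      ≈⟨ +ₚ-cong (scale-*ₚ a q r) (+ₚ-cong (scale-zero r refl) (∷-cong refl (*ₚ-assoc p q r))) ⟩
    scale a (q *ₚ r) +ₚ (0# ∷ p *ₚ (q *ₚ r)) ∎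
    where open ≋-Reasoning

  *ₚ-identityˡ : ∀ p → 1ₚ *ₚ p ≋ p
  *ₚ-identityˡ p = ≋-trans (+ₚ-cong (scale-one p) [0#]≋[]) (+ₚ-identityʳ p)

  *ₚ-identityʳ : ∀ p → p *ₚ 1ₚ ≋ p
  *ₚ-identityʳ p = ≋-trans (*ₚ-comm p 1ₚ) (*ₚ-identityˡ p)

  -- The ring operations are opaque copies of _+ₚ_, _*ₚ_ and -ₚ_: as they do not
  -- compute, unification can solve the implicit arguments of the ring laws.
  opaque
    infixl 6 _⊕_
    infixl 7 _⊛_
    infix  8 ⊝_

    _⊕_ _⊛_ : Pol → Pol → Pol
    _⊕_ = _+ₚ_
    _⊛_ = _*ₚ_

    ⊝_ : Pol → Pol
    ⊝_ = -ₚ_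

  opaque
    unfolding _⊕_ _⊛_ ⊝_

    polynomial-isCommutativeRing : IsCommutativeRing _≋_ _⊕_ _⊛_ ⊝_ 0ₚ 1ₚ
    polynomial-isCommutativeRing = record
      { isRing = record
        { +-isAbelianGroup = record
          { isGroup = record
            { isMonoid = record
              { isSemigroup = record
                { isMagma  = record { isEquivalence = Setoid.isEquivalence ≋-setoid ; ∙-cong = +ₚ-cong }
                ; assoc    = +ₚ-assoc
                }
              ; identity = (λ p → ≋-refl) , +ₚ-identityʳ
              }
            ; inverse = -ₚ-inverseˡ , -ₚ-inverseʳ
            ; ⁻¹-cong = -ₚ-cong
            }
          ; comm = +ₚ-comm
          }
        ; *-cong     = *ₚ-cong
        ; *-assoc    = *ₚ-assoc
        ; *-identity = *ₚ-identityˡ , *ₚ-identityʳ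
        ; distrib    = *ₚ-distribˡ , *ₚ-distribʳ
        }
      ; *-comm = *ₚ-comm
      }

  polynomialRing : CommutativeRing c ℓ
  polynomialRing = record { isCommutativeRing = polynomial-isCommutativeRing }

  opaque
    unfolding _⊕_ _⊛_ ⊝_

    []-⊕ : ∀ q → [] ⊕ q ≡ q
    []-⊕ q = ≡.refl

    ⊕-[] : ∀ p → p ⊕ [] ≡ p
    ⊕-[] []      = ≡.refl
    ⊕-[] (a ∷ p) = ≡.refl

    ∷-⊕-∷ : ∀ a b p q → (a ∷ p) ⊕ (b ∷ q) ≡ (a + b) ∷ (p ⊕ q)
    ∷-⊕-∷ a b p q = ≡.refl

    []-⊛ : ∀ q → [] ⊛ q ≡ []
    []-⊛ q = ≡.refl

    ∷-⊛ : ∀ a p q → (a ∷ p) ⊛ q ≡ scale a q ⊕ (0# ∷ p ⊛ q)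
    ∷-⊛ a p q = ≡.refl

    ⊝-[] : ⊝ [] ≡ []
    ⊝-[] = ≡.refl

    ⊝-∷ : ∀ a p → ⊝ (a ∷ p) ≡ (- a) ∷ ⊝ p
    ⊝-∷ a p = ≡.refl

    coeff-⊕ : ∀ p q k → coeff (p ⊕ q) k ≈ coeff p k + coeff q k
    coeff-⊕ = coeff-+ₚ

    coeff-⊝ : ∀ p k → coeff (⊝ p) k ≈ - coeff p k
    coeff-⊝ = coeff--ₚ

    X⊛ : ∀ p → X ⊛ p ≋ 0# ∷ p
    X⊛ p = +ₚ-cong (scale-zero p refl) (∷-cong refl (≋-trans (+ₚ-cong (scale-one p) [0#]≋[]) (+ₚ-identityʳ p)))

    coeff-∷⊛ : ∀ a p q k → coeff ((a ∷ p) ⊛ q) k ≈ a * coeff q k + coeff (0# ∷ p ⊛ q) k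
    coeff-∷⊛ a p q k = trans (coeff-+ₚ (scale a q) (0# ∷ p *ₚ q) k) (+-congʳ (coeff-scale a q k))

module PolynomialSubstitution {c ℓ} (R : CommutativeRing c ℓ) where

  open import Algebra.Morphism.Structures using (IsRingHomomorphism)
  open import Data.List.Base using ([]; _∷_)
  open import Data.Nat.Base as ℕ using (zero; suc)
  import Data.Nat.Properties as ℕ

  open Polynomial R
  private
    module R where
      open CommutativeRing R public
      open import Algebra.Properties.Ring ring public using (-0#≈0#; -1*x≈-x)
      open import Algebra.Properties.Semiring.Exp semiring public using (_^_)
      open import Relation.Binary.Reasoning.Setoid setoid public
  open CommutativeRing polynomialRing hiding (zero)
  open import Algebra.Properties.Ring ring using (-‿+-comm; -‿distribˡ-*; -‿distribʳ-*)
  open import Algebra.Properties.CommutativeSemigroup +-commutativeSemigroup using (interchange)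
  open import Algebra.Properties.CommutativeSemigroup *-commutativeSemigroup using (x∙yz≈y∙xz)
  open import Relation.Binary.Reasoning.Setoid setoid

  const-cong : ∀ {a b} → a R.≈ b → const a ≈ const b
  const-cong a≈b = ∷-cong a≈b ≋-refl

  opaque
    unfolding _⊕_ _⊛_ ⊝_

    const-isRingHomomorphism : IsRingHomomorphism R.rawRing rawRing const
    const-isRingHomomorphism = record
      { isSemiringHomomorphism = record
        { isNearSemiringHomomorphism = record
          { +-isMonoidHomomorphism = record
            { isMagmaHomomorphism = record
              { isRelHomomorphism = record { cong = const-cong }
              ; homo              = λ a b → ≋-refl
              }
            ; ε-homo = [0#]≋[]
            }
          ; *-homo = λ a b → const-cong (R.sym (R.+-identityʳ _))
          }
        ; 1#-homo = ≋-refl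
        }
      ; -‿homo = λ a → ≋-refl
      }

  open IsRingHomomorphism const-isRingHomomorphism public
    using () renaming (+-homo to const-+; *-homo to const-*; -‿homo to const-neg; 0#-homo to const-0)

  infixl 9 _∘ₚ_
  _∘ₚ_ : Pol → Pol → Pol
  []      ∘ₚ r = 0#
  (a ∷ p) ∘ₚ r = const a + r * (p ∘ₚ r)

  ∘ₚ-annihilated : ∀ {p} r → p ≈ [] → p ∘ₚ r ≈ 0#
  ∘ₚ-annihilated {[]}    r p≈0 = refl
  ∘ₚ-annihilated {a ∷ p} r p≈0 = begin
    const a + r * (p ∘ₚ r)    ≈⟨ +-cong (const-cong (≋⇒≈ₚ p≈0 zero)) (*-congˡ (∘ₚ-annihilated r (∷≋[]-tail p≈0))) ⟩
    const R.0# + r * 0#       ≈⟨ +-cong const-0 (zeroʳ r) ⟩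
    0# + 0#                   ≈⟨ +-identityʳ 0# ⟩
    0#                        ∎

  ∘ₚ-congˡ : ∀ {p q} r → p ≈ q → p ∘ₚ r ≈ q ∘ₚ r
  ∘ₚ-congˡ {[]}    {q}     r p≈q = sym (∘ₚ-annihilated r (sym p≈q))
  ∘ₚ-congˡ {a ∷ p} {[]}    r p≈q = ∘ₚ-annihilated r p≈q
  ∘ₚ-congˡ {a ∷ p} {b ∷ q} r p≈q = +-cong (const-cong (≋⇒≈ₚ p≈q zero)) (*-congˡ (∘ₚ-congˡ r (∷-tail p≈q)))

  ∘ₚ-+ : ∀ p q r → (p + q) ∘ₚ r ≈ p ∘ₚ r + q ∘ₚ r
  ∘ₚ-+ []      q       r rewrite []-⊕ q = sym (+-identityˡ _)
  ∘ₚ-+ (a ∷ p) []      r rewrite ⊕-[] (a ∷ p) = sym (+-identityʳ _)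
  ∘ₚ-+ (a ∷ p) (b ∷ q) r rewrite ∷-⊕-∷ a b p q = begin
    const (a R.+ b) + r * (p + q) ∘ₚ r                   ≈⟨ +-cong (const-+ a b) (*-congˡ (∘ₚ-+ p q r)) ⟩
    (const a + const b) + r * (p ∘ₚ r + q ∘ₚ r)          ≈⟨ +-congˡ (distribˡ r _ _) ⟩
    (const a + const b) + (r * p ∘ₚ r + r * q ∘ₚ r)      ≈⟨ interchange _ _ _ _ ⟩
    (const a + r * p ∘ₚ r) + (const b + r * q ∘ₚ r)      ∎

  ∘ₚ-scale : ∀ a q r → scale a q ∘ₚ r ≈ const a * q ∘ₚ r
  ∘ₚ-scale a []      r = sym (zeroʳ (const a))
  ∘ₚ-scale a (b ∷ q) r = begin
    const (a R.* b) + r * scale a q ∘ₚ r        ≈⟨ +-cong (const-* a b) (*-congˡ (∘ₚ-scale a q r)) ⟩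
    const a * const b + r * (const a * q ∘ₚ r)  ≈⟨ +-congˡ (x∙yz≈y∙xz r (const a) _) ⟩
    const a * const b + const a * (r * q ∘ₚ r)  ≈⟨ distribˡ (const a) _ _ ⟨
    const a * (const b + r * q ∘ₚ r)            ∎

  ∘ₚ-* : ∀ p q r → (p * q) ∘ₚ r ≈ p ∘ₚ r * q ∘ₚ r
  ∘ₚ-* []      q r rewrite []-⊛ q = sym (zeroˡ (q ∘ₚ r))
  ∘ₚ-* (a ∷ p) q r rewrite ∷-⊛ a p q = begin
    (scale a q + (R.0# ∷ p * q)) ∘ₚ r                   ≈⟨ ∘ₚ-+ (scale a q) (R.0# ∷ p * q) r ⟩
    scale a q ∘ₚ r + (const R.0# + r * (p * q) ∘ₚ r)    ≈⟨ +-cong (∘ₚ-scale a q r) (+-cong const-0 (*-congˡ (∘ₚ-* p q r))) ⟩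
    const a * q ∘ₚ r + (0# + r * (p ∘ₚ r * q ∘ₚ r))     ≈⟨ +-congˡ (trans (+-identityˡ _) (sym (*-assoc r _ _))) ⟩
    const a * q ∘ₚ r + r * p ∘ₚ r * q ∘ₚ r              ≈⟨ distribʳ (q ∘ₚ r) (const a) _ ⟨
    (const a + r * p ∘ₚ r) * q ∘ₚ r                     ∎

  ∘ₚ-neg : ∀ p r → (- p) ∘ₚ r ≈ - (p ∘ₚ r)
  ∘ₚ-neg []      r rewrite ⊝-[] = refl
  ∘ₚ-neg (a ∷ p) r rewrite ⊝-∷ a p = begin
    const (R.- a) + r * (- p) ∘ₚ r     ≈⟨ +-cong (const-neg a) (*-congˡ (∘ₚ-neg p r)) ⟩
    - const a + r * - (p ∘ₚ r)         ≈⟨ +-congˡ (-‿distribʳ-* r _) ⟨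
    - const a + - (r * p ∘ₚ r)         ≈⟨ -‿+-comm _ _ ⟩
    - (const a + r * p ∘ₚ r)           ∎

  ∘ₚ-const : ∀ a r → const a ∘ₚ r ≈ const a
  ∘ₚ-const a r = trans (+-congˡ (zeroʳ r)) (+-identityʳ (const a))

  -const-∘ₚ : ∀ p a r → (p - const a) ∘ₚ r ≈ p ∘ₚ r - const a
  -const-∘ₚ p a r = trans (∘ₚ-+ p (- const a) r) (+-congˡ (trans (∘ₚ-neg (const a) r) (-‿cong (∘ₚ-const a r))))

  X∘ₚ : ∀ r → X ∘ₚ r ≈ r
  X∘ₚ r = begin
    const R.0# + r * (const R.1# + r * 0#)   ≈⟨ +-cong const-0 (*-congˡ (∘ₚ-const R.1# r)) ⟩
    0# + r * 1#                              ≈⟨ trans (+-identityˡ _) (*-identityʳ r) ⟩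
    r                                        ∎

  ∘ₚ-isRingHomomorphism : ∀ r → IsRingHomomorphism rawRing rawRing (_∘ₚ r)
  ∘ₚ-isRingHomomorphism r = record
    { isSemiringHomomorphism = record
      { isNearSemiringHomomorphism = record
        { +-isMonoidHomomorphism = record
          { isMagmaHomomorphism = record
            { isRelHomomorphism = record { cong = ∘ₚ-congˡ r }
            ; homo              = λ p q → ∘ₚ-+ p q r
            }
          ; ε-homo = refl
          }
        ; *-homo = λ p q → ∘ₚ-* p q r
        }
      ; 1#-homo = ∘ₚ-const R.1# r
      }
    ; -‿homo = λ p → ∘ₚ-neg p r
    }

  X²*-shift : ∀ p → (X * X) * p ≈ R.0# ∷ R.0# ∷ p
  X²*-shift p = trans (*-assoc X X p) (trans (*-congˡ (X⊛ p)) (X⊛ (R.0# ∷ p)))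

  coeff-∘ₚX² : ∀ p k → coeff (p ∘ₚ (X * X)) (k ℕ.+ k) R.≈ coeff p k
  coeff-∘ₚX² []      k = R.refl
  coeff-∘ₚX² (a ∷ p) k = R.begin
    coeff (const a + (X * X) * p ∘ₚ (X * X)) (k ℕ.+ k)
      R.≈⟨ coeff-⊕ (const a) ((X * X) * p ∘ₚ (X * X)) (k ℕ.+ k) ⟩
    coeff (const a) (k ℕ.+ k) R.+ coeff ((X * X) * p ∘ₚ (X * X)) (k ℕ.+ k)
      R.≈⟨ R.+-congˡ (≋⇒≈ₚ (X²*-shift (p ∘ₚ (X * X))) (k ℕ.+ k)) ⟩
    coeff (const a) (k ℕ.+ k) R.+ coeff (R.0# ∷ R.0# ∷ p ∘ₚ (X * X)) (k ℕ.+ k)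
      R.≈⟨ shifted k ⟩
    coeff (a ∷ p) k R.∎
    where
    shifted : ∀ k → coeff (const a) (k ℕ.+ k) R.+ coeff (R.0# ∷ R.0# ∷ p ∘ₚ (X * X)) (k ℕ.+ k) R.≈ coeff (a ∷ p) k
    shifted zero                         = R.+-identityʳ a
    shifted (suc k) rewrite ℕ.+-suc k k = R.trans (R.+-identityˡ _) (coeff-∘ₚX² p k)

  ∘ₚX²-injective : ∀ {p q} → p ∘ₚ (X * X) ≈ q ∘ₚ (X * X) → p ≈ q
  ∘ₚX²-injective {p} {q} p∘X²≈q∘X² = ≈ₚ⇒≋ λ k →
    R.trans (R.sym (coeff-∘ₚX² p k)) (R.trans (≋⇒≈ₚ p∘X²≈q∘X² (k ℕ.+ k)) (coeff-∘ₚX² q k))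

  -X*-shift : ∀ p → (- X) * p ≈ - (R.0# ∷ p)
  -X*-shift p = trans (sym (-‿distribˡ-* X p)) (-‿cong (X⊛ p))

  coeff-∘ₚ-X : ∀ p k → coeff (p ∘ₚ (- X)) k R.≈ (R.- R.1#) R.^ k R.* coeff p k
  coeff-∘ₚ-X []      k = R.sym (R.zeroʳ _)
  coeff-∘ₚ-X (a ∷ p) k = R.begin
    coeff (const a + (- X) * p ∘ₚ (- X)) k
      R.≈⟨ coeff-⊕ (const a) ((- X) * p ∘ₚ (- X)) k ⟩
    coeff (const a) k R.+ coeff ((- X) * p ∘ₚ (- X)) k
      R.≈⟨ R.+-congˡ (R.trans (≋⇒≈ₚ (-X*-shift (p ∘ₚ (- X))) k) (coeff-⊝ (R.0# ∷ p ∘ₚ (- X)) k)) ⟩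
    coeff (const a) k R.+ R.- coeff (R.0# ∷ p ∘ₚ (- X)) k
      R.≈⟨ signed k ⟩
    (R.- R.1#) R.^ k R.* coeff (a ∷ p) k R.∎
    where
    signed : ∀ k → coeff (const a) k R.+ R.- coeff (R.0# ∷ p ∘ₚ (- X)) k R.≈ (R.- R.1#) R.^ k R.* coeff (a ∷ p) k
    signed zero    = R.trans (R.+-congˡ R.-0#≈0#) (R.trans (R.+-identityʳ a) (R.sym (R.*-identityˡ a)))
    signed (suc k) = R.trans (R.+-identityˡ _) (R.trans (R.-‿cong (coeff-∘ₚ-X p k))
                       (R.sym (R.trans (R.*-assoc _ _ _) (R.-1*x≈-x _))))

module CharacteristicPolynomial {c ℓ} (R : CommutativeRing c ℓ) where

  open import Data.Bool.Base using (true; false; if_then_else_)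
  open import Data.Fin.Base using (Fin; zero; suc; punchIn; splitAt)
  open import Data.Fin.Properties using (_≟_)
  open import Data.List.Base using ([]; _∷_)
  open import Data.Nat.Base as ℕ using (ℕ; zero; suc; z≤n; s≤s)
  import Data.Nat.Properties as ℕ
  open import Data.Product.Base using (_×_; _,_; proj₁; proj₂)
  open import Data.Sum.Base using (inj₁; inj₂)
  open import Function.Base using (_∘_)
  open import Relation.Binary.PropositionalEquality as ≡ using (_≡_)
  open import Relation.Nullary.Decidable using (does)

  open Polynomial R
  open PolynomialSubstitution R

  private
    module R where
      open CommutativeRing R public
      open import Algebra.Properties.Ring ring public using (-0#≈0#)
      open import Relation.Binary.Reasoning.Setoid setoid public
    module M = Determinant R
    module Const = RingHomomorphism R polynomialRing const-isRingHomomorphism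
    module Subst (r : Pol) = RingHomomorphism polynomialRing polynomialRing (∘ₚ-isRingHomomorphism r)

  open Determinant polynomialRing
  open CommutativeRing polynomialRing hiding (zero)
  open import Algebra.Properties.Ring ring using (-‿+-comm; -‿involutive; -0#≈0#)
  open import Algebra.Properties.Semiring.Sum semiring using (sum-cong-≋)
  open import Relation.Binary.Reasoning.Setoid setoid

  characteristicMatrix : ∀ {n} → M.Matrix n n → Matrix n n
  characteristicMatrix A i j = diagonal X i j - const (A i j)

  opaque
    unfolding _⊕_ _⊛_ ⊝_

    charPoly≡det : ∀ {n} (A : M.Matrix n n) → charPoly A ≡ det (characteristicMatrix A)
    charPoly≡det A = ≡.refl

  charPoly-cong : ∀ {n} {A B : M.Matrix n n} → (∀ i j → A i j R.≈ B i j) → charPoly A ≈ charPoly B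
  charPoly-cong {A = A} {B} A≈B = begin
    charPoly A                       ≡⟨ charPoly≡det A ⟩
    det (characteristicMatrix A)     ≈⟨ det-cong (λ i j → +-congˡ (-‿cong (const-cong (A≈B i j)))) ⟩
    det (characteristicMatrix B)     ≡⟨ charPoly≡det B ⟨
    charPoly B                       ∎

  diagonal-∘ₚ : ∀ {n} r (i j : Fin n) → diagonal X i j ∘ₚ r ≈ diagonal r i j
  diagonal-∘ₚ r i j with does (i ≟ j)
  ... | true  = X∘ₚ r
  ... | false = refl

  charPoly-∘ₚ : ∀ {n} (A : M.Matrix n n) r → charPoly A ∘ₚ r ≈ det (λ i j → diagonal r i j - const (A i j))
  charPoly-∘ₚ A r = begin
    charPoly A ∘ₚ r                                      ≡⟨ ≡.cong (_∘ₚ r) (charPoly≡det A) ⟩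
    det (characteristicMatrix A) ∘ₚ r                    ≈⟨ Subst.homo-det r (characteristicMatrix A) ⟩
    det (λ i j → characteristicMatrix A i j ∘ₚ r)        ≈⟨ det-cong entry ⟩
    det (λ i j → diagonal r i j - const (A i j))         ∎
    where
    entry : ∀ i j → characteristicMatrix A i j ∘ₚ r ≈ diagonal r i j - const (A i j)
    entry i j = trans (-const-∘ₚ (diagonal X i j) (A i j) r) (+-congʳ (diagonal-∘ₚ r i j))

  const-sign : ∀ n → const ((R.- R.1#) M.^ n) ≈ (- 1#) ^ n
  const-sign n = trans (Const.homo-^ (R.- R.1#) n) (^-congˡ n (const-neg R.1#))
    where open import Algebra.Properties.Semiring.Exp semiring using (^-congˡ)

  charPoly-neg : ∀ {n} (A : M.Matrix n n) → charPoly (λ i j → R.- A i j) ≈ (- 1#) ^ n * charPoly A ∘ₚ (- X)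
  charPoly-neg {n} A = begin
    charPoly N                                              ≡⟨ charPoly≡det N ⟩
    det (characteristicMatrix N)                            ≈⟨ *-identityˡ _ ⟨
    1# * det (characteristicMatrix N)                       ≈⟨ *-congʳ (-1^-square n) ⟨
    (- 1#) ^ n * (- 1#) ^ n * det (characteristicMatrix N)  ≈⟨ *-assoc _ _ _ ⟩
    (- 1#) ^ n * ((- 1#) ^ n * det (characteristicMatrix N))
      ≈⟨ *-congˡ (det-neg (characteristicMatrix N)) ⟨
    (- 1#) ^ n * det (λ i j → - characteristicMatrix N i j)
      ≈⟨ *-congˡ (det-cong entry) ⟩
    (- 1#) ^ n * det (λ i j → diagonal (- X) i j - const (A i j))
      ≈⟨ *-congˡ (charPoly-∘ₚ A (- X)) ⟨
    (- 1#) ^ n * charPoly A ∘ₚ (- X) ∎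
    where
    N = λ i j → R.- A i j

    diagonal-neg : ∀ i j → - diagonal X i j ≈ diagonal (- X) i j
    diagonal-neg i j with does (i ≟ j)
    ... | true  = refl
    ... | false = -0#≈0#

    entry : ∀ i j → - (diagonal X i j - const (R.- A i j)) ≈ diagonal (- X) i j - const (A i j)
    entry i j = begin
      - (diagonal X i j - const (R.- A i j))       ≈⟨ -‿cong (+-congˡ (-‿cong (const-neg (A i j)))) ⟩
      - (diagonal X i j + - - const (A i j))       ≈⟨ -‿+-comm _ _ ⟨
      - diagonal X i j + - - - const (A i j)       ≈⟨ +-cong (diagonal-neg i j) (-‿cong (-‿involutive _)) ⟩
      diagonal (- X) i j - const (A i j)           ∎

  characteristicMatrix-*ᴹ : ∀ {n} (A : M.Matrix n n) i j →
    (characteristicMatrix A *ᴹ characteristicMatrix (λ i j → R.- A i j)) i j ≈ diagonal (X * X) i j - const ((A M.*ᴹ A) i j)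
  characteristicMatrix-*ᴹ {n} A i j = begin
    ∑[ k < n ] (characteristicMatrix A i k * characteristicMatrix (λ i j → R.- A i j) k j)
      ≈⟨ sum-cong-≋ (λ k → *-congˡ (+-congˡ (trans (-‿cong (const-neg (A k j))) (-‿involutive _)))) ⟩
    ∑[ k < n ] ((diagonal X i k - B i k) * (diagonal X k j + B k j))
      ≈⟨ *ᴹ-differenceOfSquares X B i j ⟩
    diagonal (X * X) i j - (B *ᴹ B) i j
      ≈⟨ +-congˡ (-‿cong (trans (sum-cong-≋ λ k → sym (const-* (A i k) (A k j)))
                                 (sym (Const.homo-sum λ k → A i k R.* A k j)))) ⟩
    diagonal (X * X) i j - const ((A M.*ᴹ A) i j) ∎
    where
    B : Matrix n n
    B i j = const (A i j)

  charPoly-square : ∀ {n} (A : M.Matrix n n) →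
                    charPoly (A M.*ᴹ A) ∘ₚ (X * X) ≈ charPoly A * charPoly (λ i j → R.- A i j)
  charPoly-square A = begin
    charPoly (A M.*ᴹ A) ∘ₚ (X * X)
      ≈⟨ charPoly-∘ₚ (A M.*ᴹ A) (X * X) ⟩
    det (λ i j → diagonal (X * X) i j - const ((A M.*ᴹ A) i j))
      ≈⟨ det-cong (characteristicMatrix-*ᴹ A) ⟨
    det (characteristicMatrix A *ᴹ characteristicMatrix N)
      ≈⟨ det-* (characteristicMatrix A) (characteristicMatrix N) ⟨
    det (characteristicMatrix A) * det (characteristicMatrix N)
      ≡⟨ ≡.cong₂ _*_ (charPoly≡det A) (charPoly≡det N) ⟨
    charPoly A * charPoly N ∎
    where N = λ i j → R.- A i j

  ⋉K₂-matrix : ∀ {n} → M.Matrix n n → M.Matrix (n ℕ.+ n) (n ℕ.+ n)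
  ⋉K₂-matrix A = M.blockMatrix A (M.diagonal R.1#) (M.diagonal R.1#) (λ i j → R.- A i j)

  charPoly-⋉K₂ : ∀ {n} (A : M.Matrix n n) → charPoly (⋉K₂-matrix A) ≈ charPoly (A M.*ᴹ A) ∘ₚ (X * X - 1#)
  charPoly-⋉K₂ {n} A = begin
    charPoly (⋉K₂-matrix A)
      ≡⟨ charPoly≡det (⋉K₂-matrix A) ⟩
    det (characteristicMatrix (⋉K₂-matrix A))
      ≈⟨ det-cong (λ u v → trans (+-congʳ (reflexive (diagonal-blockMatrix {n} {n} X u v)))
                                 (blockwise (splitAt n u) (splitAt n v))) ⟩
    det (blockMatrix (characteristicMatrix A) (diagonal (- 1#)) (diagonal (- 1#)) (characteristicMatrix N))
      ≈⟨ det-schur (characteristicMatrix A) (diagonal (- 1#)) (characteristicMatrix N) ⟩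
    det (λ i j → (characteristicMatrix A *ᴹ characteristicMatrix N) i j + diagonal (- 1#) i j)
      ≈⟨ det-cong (λ i j → trans (+-congʳ (characteristicMatrix-*ᴹ A i j)) (shift i j)) ⟩
    det (λ i j → diagonal (X * X - 1#) i j - const ((A M.*ᴹ A) i j))
      ≈⟨ charPoly-∘ₚ (A M.*ᴹ A) (X * X - 1#) ⟨
    charPoly (A M.*ᴹ A) ∘ₚ (X * X - 1#) ∎
    where
    N = λ i j → R.- A i j

    offDiagonal : ∀ i j → 0# - const (M.diagonal R.1# i j) ≈ diagonal (- 1#) i j
    offDiagonal i j with does (i ≟ j)
    ... | true  = +-identityˡ _
    ... | false = trans (+-identityˡ _) (trans (-‿cong const-0) -0#≈0#)

    blockwise : ∀ s t → blockEntry (diagonal X) 0ᴹ 0ᴹ (diagonal X) s t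
                          - const (M.blockEntry A (M.diagonal R.1#) (M.diagonal R.1#) N s t)
                        ≈ blockEntry (characteristicMatrix A) (diagonal (- 1#)) (diagonal (- 1#)) (characteristicMatrix N) s t
    blockwise (inj₁ i) (inj₁ j) = refl
    blockwise (inj₁ i) (inj₂ j) = offDiagonal i j
    blockwise (inj₂ i) (inj₁ j) = offDiagonal i j
    blockwise (inj₂ i) (inj₂ j) = refl

    shift : ∀ i j → (diagonal (X * X) i j - const ((A M.*ᴹ A) i j)) + diagonal (- 1#) i j
                    ≈ diagonal (X * X - 1#) i j - const ((A M.*ᴹ A) i j)
    shift i j with does (i ≟ j)
    ... | true  = trans (+-assoc _ _ _) (trans (+-congˡ (+-comm _ _)) (sym (+-assoc _ _ _)))
    ... | false = +-identityʳ _

  Degree≤ : ℕ → Pol → Set ℓ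
  Degree≤ d p = ∀ k → d ℕ.< k → coeff p k R.≈ R.0#

  Degree≤-tail : ∀ {d a p} → Degree≤ (suc d) (a ∷ p) → Degree≤ d p
  Degree≤-tail deg k d<k = deg (suc k) (s≤s d<k)

  Degree≤0-tail : ∀ {a p} → Degree≤ 0 (a ∷ p) → p ≈ 0#
  Degree≤0-tail deg = ≈ₚ⇒≋ λ k → deg (suc k) (s≤s z≤n)

  coeff-shift-vanishes : ∀ {p} q → p ≈ 0# → ∀ k → coeff (R.0# ∷ p * q) k R.≈ R.0#
  coeff-shift-vanishes q p≈0 zero    = R.refl
  coeff-shift-vanishes q p≈0 (suc k) = ≋⇒≈ₚ (trans (*-congʳ p≈0) (zeroˡ q)) k

  degree-* : ∀ a b {p q} → Degree≤ a p → Degree≤ b q → Degree≤ (a ℕ.+ b) (p * q)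
  degree-* a       b {[]}    {q} _  _  k _ rewrite []-⊛ q = R.refl
  degree-* zero    b {c ∷ p} {q} dp dq k b<k = R.begin
    coeff ((c ∷ p) * q) k                             R.≈⟨ coeff-∷⊛ c p q k ⟩
    c R.* coeff q k R.+ coeff (R.0# ∷ p * q) k
      R.≈⟨ R.+-cong (R.*-congˡ (dq k b<k)) (coeff-shift-vanishes q (Degree≤0-tail dp) k) ⟩
    c R.* R.0# R.+ R.0#                               R.≈⟨ R.trans (R.+-identityʳ _) (R.zeroʳ c) ⟩
    R.0#                                              R.∎
  degree-* (suc a) b {c ∷ p} {q} dp dq (suc k) (s≤s a+b<k) = R.begin
    coeff ((c ∷ p) * q) (suc k)                       R.≈⟨ coeff-∷⊛ c p q (suc k) ⟩
    c R.* coeff q (suc k) R.+ coeff (p * q) k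
      R.≈⟨ R.+-cong (R.*-congˡ (dq (suc k) b<1+k)) (degree-* a b (Degree≤-tail dp) dq k a+b<k) ⟩
    c R.* R.0# R.+ R.0#                               R.≈⟨ R.trans (R.+-identityʳ _) (R.zeroʳ c) ⟩
    R.0#                                              R.∎
    where b<1+k = s≤s (ℕ.≤-trans (ℕ.m≤n+m b a) (ℕ.<⇒≤ a+b<k))

  coeff-*-top : ∀ a b {p q} → Degree≤ a p → Degree≤ b q → coeff (p * q) (a ℕ.+ b) R.≈ coeff p a R.* coeff q b
  coeff-*-top a       b {[]}    {q} _  _  rewrite []-⊛ q = R.sym (R.zeroˡ _)
  coeff-*-top zero    b {c ∷ p} {q} dp dq = R.begin
    coeff ((c ∷ p) * q) b                             R.≈⟨ coeff-∷⊛ c p q b ⟩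
    c R.* coeff q b R.+ coeff (R.0# ∷ p * q) b        R.≈⟨ R.+-congˡ (coeff-shift-vanishes q (Degree≤0-tail dp) b) ⟩
    c R.* coeff q b R.+ R.0#                          R.≈⟨ R.+-identityʳ _ ⟩
    c R.* coeff q b                                   R.∎
  coeff-*-top (suc a) b {c ∷ p} {q} dp dq = R.begin
    coeff ((c ∷ p) * q) (suc (a ℕ.+ b))               R.≈⟨ coeff-∷⊛ c p q (suc (a ℕ.+ b)) ⟩
    c R.* coeff q (suc (a ℕ.+ b)) R.+ coeff (p * q) (a ℕ.+ b)
      R.≈⟨ R.+-cong (R.*-congˡ (dq (suc (a ℕ.+ b)) (s≤s (ℕ.m≤n+m b a)))) (coeff-*-top a b (Degree≤-tail dp) dq) ⟩
    c R.* R.0# R.+ coeff p a R.* coeff q b            R.≈⟨ R.trans (R.+-congʳ (R.zeroʳ c)) (R.+-identityˡ _) ⟩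
    coeff p a R.* coeff q b                           R.∎

  coeff-altSum : ∀ {m} (g : Fin m → Pol) k → coeff (altSum g) k R.≈ M.altSum (λ j → coeff (g j) k)
  coeff-altSum {zero}  g k = R.refl
  coeff-altSum {suc m} g k = R.trans (coeff-⊕ (g zero) _ k)
    (R.+-congˡ (R.trans (coeff-⊝ (altSum (g ∘ suc)) k) (R.-‿cong (coeff-altSum (g ∘ suc) k))))

  det-leading : ∀ {n} (N : Matrix n n) → (∀ i j → Degree≤ 1 (N i j)) →
                Degree≤ n (det N) × coeff (det N) n R.≈ M.det (λ i j → coeff (N i j) 1)
  det-leading {zero}  N deg = (λ { (suc k) _ → R.refl }) , R.refl
  det-leading {suc n} N deg = degree , top
    where
    T : Fin (suc n) → Pol
    T j = N zero j * det (minor N j)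

    leading : ∀ j → Degree≤ n (det (minor N j)) × coeff (det (minor N j)) n R.≈ M.det (λ a b → coeff (minor N j a b) 1)
    leading j = det-leading (minor N j) (λ a b → deg (suc a) (punchIn j b))

    degree : Degree≤ (suc n) (det N)
    degree k n<k = R.trans (coeff-altSum T k) (M.altSum-zero (λ j → coeff (T j) k)
      λ j → degree-* 1 n {N zero j} {det (minor N j)} (deg zero j) (proj₁ (leading j)) k n<k)

    top : coeff (det N) (suc n) R.≈ M.det (λ i j → coeff (N i j) 1)
    top = R.trans (coeff-altSum T (suc n)) (M.altSum-cong λ j →
      R.trans (coeff-*-top 1 n {N zero j} {det (minor N j)} (deg zero j) (proj₁ (leading j))) (R.*-congˡ (proj₂ (leading j))))

  charPoly-leading : ∀ {n} (A : M.Matrix n n) → coeff (charPoly A) n R.≈ R.1#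
  charPoly-leading {n} A = R.begin
    coeff (charPoly A) n                                        R.≡⟨ ≡.cong (λ p → coeff p n) (charPoly≡det A) ⟩
    coeff (det (characteristicMatrix A)) n                      R.≈⟨ proj₂ (det-leading (characteristicMatrix A) degree≤1) ⟩
    M.det (λ i j → coeff (characteristicMatrix A i j) 1)        R.≈⟨ M.det-cong coeff₁ ⟩
    M.det {n} (M.diagonal R.1#)                                 R.≈⟨ M.det-diagonal {n} R.1# ⟩
    R.1# M.^ n                                                  R.≈⟨ 1^n n ⟩
    R.1#                                                        R.∎
    where
    entry : ∀ i j k → coeff (characteristicMatrix A i j) k R.≈ coeff (diagonal X i j) k R.+ R.- coeff (const (A i j)) k
    entry i j k = R.trans (coeff-⊕ (diagonal X i j) _ k) (R.+-congˡ (coeff-⊝ (const (A i j)) k))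

    degree≤1 : ∀ i j → Degree≤ 1 (characteristicMatrix A i j)
    degree≤1 i j (suc zero)    (s≤s ())
    degree≤1 i j (suc (suc k)) _ =
      R.trans (entry i j (suc (suc k))) (R.trans (R.+-congˡ R.-0#≈0#) (R.trans (R.+-identityʳ _) (top (does (i ≟ j)))))
      where
      top : ∀ b → coeff (if b then X else 0#) (suc (suc k)) R.≈ R.0#
      top true  = R.refl
      top false = R.refl

    coeff₁ : ∀ i j → coeff (characteristicMatrix A i j) 1 R.≈ M.diagonal R.1# i j
    coeff₁ i j = R.trans (entry i j 1) (R.trans (R.+-congˡ R.-0#≈0#) (R.trans (R.+-identityʳ _) (linear (does (i ≟ j)))))
      where
      linear : ∀ b → coeff (if b then X else 0#) 1 R.≈ (if b then R.1# else R.0#)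
      linear true  = R.refl
      linear false = R.refl

    1^n : ∀ n → R.1# M.^ n R.≈ R.1#
    1^n zero    = R.refl
    1^n (suc n) = R.trans (R.*-identityˡ _) (1^n n)

  coeff-const* : ∀ a p k → coeff (const a * p) k R.≈ a R.* coeff p k
  coeff-const* a p k =
    R.trans (coeff-∷⊛ a [] p k) (R.trans (R.+-congˡ (coeff-shift-vanishes p refl k)) (R.+-identityʳ _))

  -- Compare the coefficients of xⁿ, using that χ_A is monic of degree n.
  charPoly-parity : ∀ {n} (A : M.Matrix n n) ε →
                    charPoly A ∘ₚ (- X) ≈ const ε * charPoly A → ε R.≈ (R.- R.1#) M.^ n
  charPoly-parity {n} A ε χ∘-X≈εχ = R.begin
    ε                                             R.≈⟨ R.*-identityʳ ε ⟨
    ε R.* R.1#                                    R.≈⟨ R.*-congˡ (charPoly-leading A) ⟨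
    ε R.* coeff (charPoly A) n                    R.≈⟨ coeff-const* ε (charPoly A) n ⟨
    coeff (const ε * charPoly A) n                R.≈⟨ ≋⇒≈ₚ χ∘-X≈εχ n ⟨
    coeff (charPoly A ∘ₚ (- X)) n                 R.≈⟨ coeff-∘ₚ-X (charPoly A) n ⟩
    (R.- R.1#) M.^ n R.* coeff (charPoly A) n     R.≈⟨ R.*-congˡ (charPoly-leading A) ⟩
    (R.- R.1#) M.^ n R.* R.1#                     R.≈⟨ R.*-identityʳ _ ⟩
    (R.- R.1#) M.^ n                              R.∎

  charPoly-square-of-parity : ∀ {n} (A : M.Matrix n n) ε → charPoly A ∘ₚ (- X) ≈ const ε * charPoly A →
                              charPoly (A M.*ᴹ A) ∘ₚ (X * X) ≈ charPoly A * charPoly A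
  charPoly-square-of-parity {n} A ε χ∘-X≈εχ = begin
    charPoly (A M.*ᴹ A) ∘ₚ (X * X)              ≈⟨ charPoly-square A ⟩
    χ * charPoly (λ i j → R.- A i j)            ≈⟨ *-congˡ (charPoly-neg A) ⟩
    χ * ((- 1#) ^ n * χ ∘ₚ (- X))               ≈⟨ *-congˡ (*-congˡ χ∘-X≈εχ) ⟩
    χ * ((- 1#) ^ n * (const ε * χ))            ≈⟨ *-congˡ (*-congˡ (*-congʳ ε≈sign)) ⟩
    χ * ((- 1#) ^ n * ((- 1#) ^ n * χ))         ≈⟨ *-congˡ (*-assoc _ _ _) ⟨
    χ * ((- 1#) ^ n * (- 1#) ^ n * χ)           ≈⟨ *-congˡ (trans (*-congʳ (-1^-square n)) (*-identityˡ χ)) ⟩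
    χ * χ                                       ∎
    where
    χ = charPoly A

    ε≈sign : const ε ≈ (- 1#) ^ n
    ε≈sign = trans (const-cong (charPoly-parity A ε χ∘-X≈εχ)) (const-sign n)

module ⋉K₂Spectrum {c ℓ} (R : CommutativeRing c ℓ) where

  open import Data.Bool.Base using (true; false; if_then_else_)
  open import Data.Fin.Base using (zero; suc; splitAt)
  open import Data.Fin.Properties using (_≟_)
  open import Data.Maybe.Base as Maybe using (just; nothing)
  import Data.Nat.Base as ℕ
  import Data.Nat.Properties as ℕ
  import Data.Sign.Base as Sign
  open import Data.Sum.Base using (inj₁; inj₂)
  open import Function.Base using (_∘_)
  open import Relation.Binary.PropositionalEquality as ≡ using (_≡_)
  open import Relation.Nullary.Decidable using (does)

  open Polynomial R
  open PolynomialSubstitution R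
  open CharacteristicPolynomial R

  private
    module R where
      open CommutativeRing R public
      open import Algebra.Properties.Ring ring public using (-0#≈0#; -‿involutive)
    module M = Determinant R
    module Subst (r : Pol) = RingHomomorphism polynomialRing polynomialRing (∘ₚ-isRingHomomorphism r)

  open CommutativeRing polynomialRing hiding (zero)
  open Determinant polynomialRing using (_^_; product; -1^-square)
  open import Algebra.Properties.Ring ring using (-1*x≈-x)
  open import Algebra.Properties.Semiring.Exp semiring using (^-congˡ; ^-homo-*)
  open import Algebra.Properties.CommutativeSemiring.Exp commutativeSemiring using (^-distrib-*)
  open import Algebra.Properties.CommutativeMonoid.Sum *-commutativeMonoid
    using () renaming (sum-cong-≋ to product-cong; ∑-distrib-+ to product-distrib)
  open import Algebra.Properties.CommutativeSemigroup *-commutativeSemigroup using () renaming (interchange to *-interchange)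
  open import Relation.Binary.Reasoning.Setoid setoid

  signEntry-opposite : ∀ e → signEntry (Maybe.map Sign.opposite e) R.≈ R.- signEntry e
  signEntry-opposite nothing         = R.sym R.-0#≈0#
  signEntry-opposite (just Sign.+)   = R.refl
  signEntry-opposite (just Sign.-)   = R.sym (R.-‿involutive R.1#)

  signEntry-link : ∀ {n} (i j : Fin n) → signEntry (if does (i ≟ j) then just Sign.+ else nothing) R.≈ M.diagonal R.1# i j
  signEntry-link i j with does (i ≟ j)
  ... | true  = R.refl
  ... | false = R.refl

  adjacency-⋉K₂ : ∀ {n} (G : SignedGraph n) u v → adjacency (G ⋉K₂) u v R.≈ ⋉K₂-matrix (adjacency G) u v
  adjacency-⋉K₂ {n} G u v with splitAt n u | splitAt n v
  ... | inj₁ i | inj₁ j = R.refl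
  ... | inj₁ i | inj₂ j = signEntry-link i j
  ... | inj₂ i | inj₁ j = signEntry-link i j
  ... | inj₂ i | inj₂ j = signEntry-opposite (edge G i j)

  opaque
    unfolding _⊕_ _⊛_ ⊝_

    ^ₚ≡^ : ∀ p k → p ^ₚ k ≡ p ^ k
    ^ₚ≡^ p ℕ.zero    = ≡.refl
    ^ₚ≡^ p (ℕ.suc k) = ≡.cong (p *ₚ_) (^ₚ≡^ p k)

    ∏ₚ-^ₚ≡product-^ : ∀ {l} (g : Fin l → Pol) (e : Fin l → ℕ) →
                      ∏ₚ (λ i → g i ^ₚ e i) ≡ product (λ i → g i ^ e i)
    ∏ₚ-^ₚ≡product-^ {ℕ.zero}  g e = ≡.refl
    ∏ₚ-^ₚ≡product-^ {ℕ.suc l} g e = ≡.cong₂ _*ₚ_ (^ₚ≡^ (g zero) (e zero)) (∏ₚ-^ₚ≡product-^ (g ∘ suc) (e ∘ suc))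

  module Factorisation {l} (m₀ : ℕ) (λs : Fin l → R.Carrier) (ms : Fin l → ℕ) where

    quadratic linear : Fin l → Pol
    quadratic i = X ^ 2 - const (λs i)
    linear    i = X - const (λs i)

    quadratics : Pol
    quadratics = product (λ i → quadratic i ^ ms i)

    factored factoredSquare factored⋉K₂ : Pol
    factored       = X ^ m₀ * quadratics
    factoredSquare = X ^ m₀ * product (λ i → linear i ^ (2 ℕ.* ms i))
    factored⋉K₂    = (X ^ 2 - 1#) ^ m₀ * product (λ i → (quadratic i - 1#) ^ (2 ℕ.* ms i))

    X²≈X*X : X ^ 2 ≈ X * X
    X²≈X*X = *-congˡ (*-identityʳ X)

    -X≈-1*X : - X ≈ - 1# * X
    -X≈-1*X = sym (-1*x≈-x X)

    factored-∘ₚ-X : factored ∘ₚ (- X) ≈ const ((R.- R.1#) M.^ m₀) * factored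
    factored-∘ₚ-X = begin
      (X ^ m₀ * quadratics) ∘ₚ (- X)                    ≈⟨ ∘ₚ-* (X ^ m₀) quadratics (- X) ⟩
      (X ^ m₀) ∘ₚ (- X) * quadratics ∘ₚ (- X)           ≈⟨ *-cong odd even ⟩
      (- 1#) ^ m₀ * X ^ m₀ * quadratics                 ≈⟨ *-assoc _ _ _ ⟩
      (- 1#) ^ m₀ * (X ^ m₀ * quadratics)               ≈⟨ *-congʳ (const-sign m₀) ⟨
      const ((R.- R.1#) M.^ m₀) * (X ^ m₀ * quadratics) ∎
      where
      odd : (X ^ m₀) ∘ₚ (- X) ≈ (- 1#) ^ m₀ * X ^ m₀
      odd = trans (Subst.homo-^ (- X) X m₀) (trans (^-congˡ m₀ (trans (X∘ₚ (- X)) -X≈-1*X)) (^-distrib-* (- 1#) X m₀))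

      -X²≈X² : (- X) ^ 2 ≈ X ^ 2
      -X²≈X² = begin
        (- X) ^ 2                    ≈⟨ trans (^-congˡ 2 -X≈-1*X) (^-distrib-* (- 1#) X 2) ⟩
        (- 1#) ^ 2 * X ^ 2           ≈⟨ *-congʳ (trans (^-homo-* (- 1#) 1 1) (-1^-square 1)) ⟩
        1# * X ^ 2                   ≈⟨ *-identityˡ _ ⟩
        X ^ 2                        ∎

      evenFactor : ∀ i → (quadratic i ^ ms i) ∘ₚ (- X) ≈ quadratic i ^ ms i
      evenFactor i = trans (Subst.homo-^ (- X) (quadratic i) (ms i)) (^-congˡ (ms i) (begin
        quadratic i ∘ₚ (- X)                    ≈⟨ -const-∘ₚ (X ^ 2) (λs i) (- X) ⟩
        (X ^ 2) ∘ₚ (- X) - const (λs i)         ≈⟨ +-congʳ (trans (Subst.homo-^ (- X) X 2) (^-congˡ 2 (X∘ₚ (- X)))) ⟩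
        (- X) ^ 2 - const (λs i)                ≈⟨ +-congʳ -X²≈X² ⟩
        quadratic i                             ∎))

      even : quadratics ∘ₚ (- X) ≈ quadratics
      even = trans (Subst.homo-product (- X) (λ i → quadratic i ^ ms i)) (product-cong {l} evenFactor)

    factored-squared : factored * factored ≈ factoredSquare ∘ₚ (X * X)
    factored-squared = begin
      (X ^ m₀ * quadratics) * (X ^ m₀ * quadratics)
        ≈⟨ *-interchange _ _ _ _ ⟩
      (X ^ m₀ * X ^ m₀) * (quadratics * quadratics)
        ≈⟨ *-cong (^-distrib-* X X m₀) (product-distrib (λ i → quadratic i ^ ms i) (λ i → quadratic i ^ ms i)) ⟨
      (X * X) ^ m₀ * product (λ i → quadratic i ^ ms i * quadratic i ^ ms i)
        ≈⟨ *-cong (sym (trans (Subst.homo-^ (X * X) X m₀) (^-congˡ m₀ (X∘ₚ (X * X)))))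
                  (trans (product-cong {l} doubled) (sym (Subst.homo-product (X * X) (λ i → linear i ^ (2 ℕ.* ms i))))) ⟩
      (X ^ m₀) ∘ₚ (X * X) * product (λ i → linear i ^ (2 ℕ.* ms i)) ∘ₚ (X * X)
        ≈⟨ ∘ₚ-* (X ^ m₀) _ (X * X) ⟨
      factoredSquare ∘ₚ (X * X) ∎
      where
      doubled : ∀ i → quadratic i ^ ms i * quadratic i ^ ms i ≈ (linear i ^ (2 ℕ.* ms i)) ∘ₚ (X * X)
      doubled i = begin
        quadratic i ^ ms i * quadratic i ^ ms i
          ≈⟨ ^-homo-* (quadratic i) (ms i) (ms i) ⟨
        quadratic i ^ (ms i ℕ.+ ms i)
          ≡⟨ ≡.cong (λ k → quadratic i ^ (ms i ℕ.+ k)) (ℕ.+-identityʳ (ms i)) ⟨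
        quadratic i ^ (2 ℕ.* ms i)
          ≈⟨ ^-congˡ (2 ℕ.* ms i) (+-congʳ (trans X²≈X*X (sym (X∘ₚ (X * X))))) ⟩
        (X ∘ₚ (X * X) - const (λs i)) ^ (2 ℕ.* ms i)
          ≈⟨ ^-congˡ (2 ℕ.* ms i) (-const-∘ₚ X (λs i) (X * X)) ⟨
        linear i ∘ₚ (X * X) ^ (2 ℕ.* ms i)
          ≈⟨ Subst.homo-^ (X * X) (linear i) (2 ℕ.* ms i) ⟨
        (linear i ^ (2 ℕ.* ms i)) ∘ₚ (X * X) ∎

    factoredSquare-∘ₚ : factoredSquare ∘ₚ (X * X - 1#) ≈ factored⋉K₂
    factoredSquare-∘ₚ = begin
      factoredSquare ∘ₚ (X * X - 1#)
        ≈⟨ ∘ₚ-* (X ^ m₀) _ (X * X - 1#) ⟩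
      (X ^ m₀) ∘ₚ (X * X - 1#) * product (λ i → linear i ^ (2 ℕ.* ms i)) ∘ₚ (X * X - 1#)
        ≈⟨ *-cong (trans (Subst.homo-^ (X * X - 1#) X m₀) (^-congˡ m₀ (trans (X∘ₚ _) (+-congʳ (sym X²≈X*X)))))
                  (trans (Subst.homo-product (X * X - 1#) (λ i → linear i ^ (2 ℕ.* ms i))) (product-cong {l} shifted)) ⟩
      factored⋉K₂ ∎
      where
      shifted : ∀ i → (linear i ^ (2 ℕ.* ms i)) ∘ₚ (X * X - 1#) ≈ (quadratic i - 1#) ^ (2 ℕ.* ms i)
      shifted i = trans (Subst.homo-^ (X * X - 1#) (linear i) (2 ℕ.* ms i)) (^-congˡ (2 ℕ.* ms i) (begin
        linear i ∘ₚ (X * X - 1#)      ≈⟨ -const-∘ₚ X (λs i) (X * X - 1#) ⟩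
        X ∘ₚ (X * X - 1#) - const (λs i) ≈⟨ +-congʳ (X∘ₚ (X * X - 1#)) ⟩
        (X * X - 1#) - const (λs i)   ≈⟨ trans (+-assoc _ _ _) (trans (+-congˡ (+-comm _ _)) (sym (+-assoc _ _ _))) ⟩
        (X * X - const (λs i)) - 1#   ≈⟨ +-congʳ (+-congʳ (sym X²≈X*X)) ⟩
        quadratic i - 1#              ∎))

    charPoly-G⋉K₂ : ∀ {n} (G : SignedGraph n) → charPoly (adjacency G) ≈ factored →
                    charPoly (adjacency (G ⋉K₂)) ≈ factored⋉K₂
    charPoly-G⋉K₂ G χ≈factored = begin
      charPoly (adjacency (G ⋉K₂))           ≈⟨ charPoly-cong (adjacency-⋉K₂ G) ⟩
      charPoly (⋉K₂-matrix A)                ≈⟨ charPoly-⋉K₂ A ⟩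
      charPoly (A M.*ᴹ A) ∘ₚ (X * X - 1#)    ≈⟨ ∘ₚ-congˡ (X * X - 1#) A²≈factoredSquare ⟩
      factoredSquare ∘ₚ (X * X - 1#)         ≈⟨ factoredSquare-∘ₚ ⟩
      factored⋉K₂                            ∎
      where
      A = adjacency G

      χ-∘ₚ-X : charPoly A ∘ₚ (- X) ≈ const ((R.- R.1#) M.^ m₀) * charPoly A
      χ-∘ₚ-X = trans (∘ₚ-congˡ (- X) χ≈factored) (trans factored-∘ₚ-X (*-congˡ (sym χ≈factored)))

      A²≈factoredSquare : charPoly (A M.*ᴹ A) ≈ factoredSquare
      A²≈factoredSquare = ∘ₚX²-injective (begin
        charPoly (A M.*ᴹ A) ∘ₚ (X * X)   ≈⟨ charPoly-square-of-parity A _ χ-∘ₚ-X ⟩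
        charPoly A * charPoly A          ≈⟨ *-cong χ≈factored χ≈factored ⟩
        factored * factored              ≈⟨ factored-squared ⟩
        factoredSquare ∘ₚ (X * X)        ∎)

    opaque
      unfolding _⊕_ _⊛_ ⊝_

      hypothesis≡ : (X ^ₚ m₀) *ₚ ∏ₚ (λ i → ((X ^ₚ 2) -ₚ const (λs i)) ^ₚ ms i) ≡ factored
      hypothesis≡ = ≡.cong₂ _*ₚ_ (^ₚ≡^ X m₀) (∏ₚ-^ₚ≡product-^ (λ i → (X ^ₚ 2) -ₚ const (λs i)) ms)

      conclusion≡ : ((X ^ₚ 2) -ₚ 1ₚ) ^ₚ m₀ *ₚ ∏ₚ (λ i → ((X ^ₚ 2) -ₚ const (λs i) -ₚ 1ₚ) ^ₚ (2 ℕ.* ms i))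
                    ≡ factored⋉K₂
      conclusion≡ = ≡.cong₂ _*ₚ_ (^ₚ≡^ ((X ^ₚ 2) -ₚ 1ₚ) m₀)
        (∏ₚ-^ₚ≡product-^ (λ i → (X ^ₚ 2) -ₚ const (λs i) -ₚ 1ₚ) (λ i → 2 ℕ.* ms i))

open import Data.Nat using (_*_)

lemma3p7 : ∀ {c ℓ} (R : CommutativeRing c ℓ) → let open Poly R in
    ∀ {n} (G : SignedGraph n) (m₀ l : ℕ) (λs : Fin l → CommutativeRing.Carrier R) (ms : Fin l → ℕ) →
    charPoly (adjacency G) ≈ₚ (X ^ₚ m₀) *ₚ ∏ₚ (λ i → ((X ^ₚ 2) -ₚ const (λs i)) ^ₚ ms i) →
    charPoly (adjacency (G ⋉K₂)) ≈ₚ ((X ^ₚ 2) -ₚ 1ₚ) ^ₚ m₀ *ₚ ∏ₚ (λ i → ((X ^ₚ 2) -ₚ const (λs i) -ₚ 1ₚ) ^ₚ (2 * ms i))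
lemma3p7 R G m₀ l λs ms χ≈ = ≋⇒≈ₚ (≋-trans
  (charPoly-G⋉K₂ G (≋-trans (≈ₚ⇒≋ χ≈) (≋-reflexive hypothesis≡)))
  (≋-reflexive (≡.sym conclusion≡)))
  where
  open ⋉K₂Spectrum.Factorisation R m₀ λs ms
  open Polynomial R using (≋⇒≈ₚ; ≈ₚ⇒≋; ≋-trans; ≋-reflexive)
  open import Relation.Binary.PropositionalEquality as ≡ using ()
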